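{- Let $n\ge1$, $(\alpha_1,\dots,\alpha_n)\in(\mathbb{N}^*)^n$ and $(\beta_1,\dots,\beta_n)\in(\mathbb{N}^*)^n$ with $\beta_i\ne\beta_j$ for $i\ne j$. Put $\rho=\alpha_2+\dots+\alpha_n$, $\theta=\alpha_1+\dots+\alpha_n$, and $\gamma=(\gamma_1,\dots,\gamma_\theta)=(\beta_1,\dots,\beta_1,\dots,\beta_n,\dots,\beta_n)$ ($\beta_j$ repeated $\alpha_j$ times). For $\sigma\in\mathfrak{S}_\rho$ and $1\le k\le\alpha_1$ define $\tilde\sigma_{k,0}\in\mathfrak{S}_\theta$ by $\tilde\sigma_{k,0}(j)=j$ for $1\le j\le\alpha_1-k+1$, $\tilde\sigma_{k,0}(\alpha_1-k+1+t)=\sigma(t)+\alpha_1$ for $1\le t\le\rho$, and $\tilde\sigma_{k,0}(\theta-k+1+t)=\alpha_1-k+1+t$ for $1\le t\le k-1$; for $1\le s\le\rho$ let $\tau_{k,s}\in\mathfrak{S}_\theta$ be the transposition $(\alpha_1-k+s\ \ \alpha_1-k+s+1)$ and $\tilde\sigma_{k,s}=\tilde\sigma_{k,s-1}\circ\tau_{k,s}$. Let $w_{\gamma,\pi}=W_{(\gamma_{\pi(1)},\dots,\gamma_{\pi(\theta)})}$ for $\pi\in\mathfrak{S}_\theta$. Then the element $$P_\gamma=\frac{1}{\alpha_2!\cdots\alpha_n!}\sum_{\sigma\in\mathfrak{S}_\rho}\sum_{k=1}^{\alpha_1}(-1)^{k-1}\binom{\alpha_1-1}{k-1}\sum_{s=0}^{\rho}(-1)^s\binom{\rho}{s}w_{\gamma,\tilde\sigma_{k,s}}$$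 of $\mathbf{ISPW}$ is primitive.
   Context: $\mathbb{K}$ is a field of characteristic $0$. For a composition $\alpha=(\alpha_1,\dots,\alpha_k)$ of positive integers, $W_\alpha$ denotes the word $x_1^{\alpha_1}\cdots x_k^{\alpha_k}$ ($\alpha_1$ letters $x_1$, then $\alpha_2$ letters $x_2$, …). $\mathbf{ISPW}$ is the vector space with basis $(W_\alpha)$ (including $W_{()}=1$), product $W_\alpha\ast W_\beta=W_{\alpha\beta}$ (concatenation of compositions) and coproduct $\Delta(W_{(\alpha_1,\dots,\alpha_k)})=\sum_{I\sqcup U=\{1,\dots,k\}}W_{(\alpha_{i_1},\dots,\alpha_{i_p})}\otimes W_{(\alpha_{u_1},\dots,\alpha_{u_s})}$ with $I=\{i_1<\dots<i_p\}$, $U=\{u_1<\dots<u_s\}$; it is a graded connected cocommutative Hopf algebra. $\mathfrak{S}_0$ is the one-element group. An element $p$ is primitive if $\Delta(p)=p\otimes1+1\otimes p$. -}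

module Defs where

open import Level using (Level; _⊔_) renaming (suc to lsuc)
open import Algebra.Bundles using (CommutativeRing)
open import Data.Nat using (ℕ; zero; suc; _+_; _∸_; _≤ᵇ_; _≡ᵇ_; _!)
open import Data.Nat.Properties using () renaming (_≟_ to _≟ℕ_)
open import Data.Nat.Combinatorics using (_C_)
open import Data.Bool using (Bool; true; false; if_then_else_)
open import Data.Fin using (Fin)
open import Data.List using (List; []; _∷_; map; concatMap; concat; replicate; tabulate; upTo; foldr)
import Data.List as List
open import Data.List.Properties using (≡-dec)
open import Data.Nat.ListAction using (sum; product)
open import Data.Product using (Σ; _×_; _,_)
open import Relation.Nullary using (¬_; yes; no)

module _ {c ℓ : Level} (R : CommutativeRing c ℓ) where
  open CommutativeRing R using (Carrier; 0#; 1#; -_) renaming (_+_ to _+R_)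

  ℕ→R : ℕ → Carrier
  ℕ→R zero = 0#
  ℕ→R (suc n) = 1# +R ℕ→R n

  sgn : ℕ → Carrier
  sgn zero = 1#
  sgn (suc e) = - sgn e

record CharZeroField (c ℓ : Level) : Set (lsuc (c ⊔ ℓ)) where
  field
    cring : CommutativeRing c ℓ
  open CommutativeRing cring public hiding (ring)
  field
    1≉0      : ¬ (1# ≈ 0#)
    inverse  : ∀ x → ¬ (x ≈ 0#) → Σ Carrier λ y → x * y ≈ 1#
    charZero : ∀ n → ¬ (ℕ→R cring (suc n) ≈ 0#)

Composition : Set
Composition = List ℕ

-- 1-indexed lookup: at l i = i-th entry of l (0 if out of range)
at : List ℕ → ℕ → ℕ
at [] _ = 0
at (x ∷ xs) zero = 0
at (x ∷ xs) (suc zero) = x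
at (x ∷ xs) (suc (suc i)) = at xs (suc i)

oneTo : ℕ → List ℕ
oneTo n = map suc (upTo n)

insertions : ℕ → List ℕ → List (List ℕ)
insertions x [] = (x ∷ []) ∷ []
insertions x (y ∷ ys) = (x ∷ y ∷ ys) ∷ map (y ∷_) (insertions x ys)

-- all permutations of {1,...,n}, in one-line notation (σ(1), ..., σ(n))
perms : ℕ → List (List ℕ)
perms zero = [] ∷ []
perms (suc n) = concatMap (insertions (suc n)) (perms n)

-- The Hopf algebra ISPW over a commutative ring, as finitely supported
-- formal linear combinations of the basis words W_α

module ISPW {c ℓ : Level} (R : CommutativeRing c ℓ) where
  open CommutativeRing R using (Carrier; 0#; _≈_) renaming (_+_ to _+R_)

  Elt : Set c
  Elt = List (Carrier × Composition)

  -- element of ISPW ⊗ ISPW: formal sum Σ c_i W_{α_i} ⊗ W_{β_i}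
  Elt₂ : Set c
  Elt₂ = List (Carrier × Composition × Composition)

  coeff : Elt → Composition → Carrier
  coeff [] α = 0#
  coeff ((a , w) ∷ p) α with ≡-dec _≟ℕ_ w α
  ... | yes _ = a +R coeff p α
  ... | no  _ = coeff p α

  coeff₂ : Elt₂ → Composition → Composition → Carrier
  coeff₂ [] α β = 0#
  coeff₂ ((a , u , v) ∷ p) α β with ≡-dec _≟ℕ_ u α | ≡-dec _≟ℕ_ v β
  ... | yes _ | yes _ = a +R coeff₂ p α β
  ... | _     | _     = coeff₂ p α β

  -- all pairs (α_I , α_U) for I ⊔ U = {1..k}, order preserved
  splits : Composition → List (Composition × Composition)
  splits [] = ([] , []) ∷ []
  splits (a ∷ as) = concatMap (λ { (l , r) → (a ∷ l , r) ∷ (l , a ∷ r) ∷ [] }) (splits as)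

  Δ : Elt → Elt₂
  Δ = concatMap (λ { (a , w) → map (λ { (l , r) → (a , l , r) }) (splits w) })

  prim-rhs : Elt → Elt₂
  prim-rhs p = List._++_ (map (λ { (a , w) → (a , w , []) }) p)
                         (map (λ { (a , w) → (a , [] , w) }) p)

  Primitive : Elt → Set ℓ
  Primitive p = ∀ u v → coeff₂ (Δ p) u v ≈ coeff₂ (prim-rhs p) u v

module Construction (m : ℕ) (α β : Fin (suc m) → ℕ) where

  ρ : ℕ
  ρ = sum (tabulate {n = m} (λ i → α (Fin.suc i)))

  α₁ : ℕ
  α₁ = α Fin.zero

  θ : ℕ
  θ = α₁ + ρ

  γ : List ℕ
  γ = concat (tabulate {n = suc m} (λ j → replicate (α j) (β j)))

  factProd : ℕ
  factProd = product (tabulate {n = m} (λ i → (α (Fin.suc i)) !))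

  σ̃₀ : List ℕ → ℕ → ℕ → ℕ
  σ̃₀ σ k j =
    if j ≤ᵇ (α₁ ∸ k + 1) then j
    else if j ≤ᵇ (α₁ ∸ k + 1 + ρ) then at σ (j ∸ (α₁ ∸ k + 1)) + α₁
    else (α₁ ∸ k + 1) + (j ∸ (θ ∸ k + 1))

  τ : ℕ → ℕ → ℕ → ℕ
  τ k s j =
    if j ≡ᵇ (α₁ ∸ k + s) then α₁ ∸ k + s + 1
    else if j ≡ᵇ (α₁ ∸ k + s + 1) then α₁ ∸ k + s
    else j

  σ̃ : List ℕ → ℕ → ℕ → ℕ → ℕ
  σ̃ σ k zero j = σ̃₀ σ k j
  σ̃ σ k (suc s) j = σ̃ σ k s (τ k (suc s) j)

  w : (ℕ → ℕ) → Composition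
  w π = map (λ i → at γ (π i)) (oneTo θ)

  module _ {c ℓ : Level} (R : CommutativeRing c ℓ) where
    open CommutativeRing R using (Carrier) renaming (_*_ to _*R_)
    open ISPW R

    -- P_γ, where `inv` plays the role of 1/(α₂! ⋯ αₙ!)
    P : Carrier → Elt
    P inv =
      concatMap (λ σ →
      concatMap (λ k →
      map (λ s →
        ( inv *R ((sgn R (k ∸ 1) *R ℕ→R R ((α₁ ∸ 1) C (k ∸ 1)))
                 *R (sgn R s *R ℕ→R R (ρ C s)))
        , w (σ̃ σ k s) ))
        (upTo (suc ρ)))
        (oneTo α₁))
        (perms ρ)

module Submission where

-- Identify an element ∑ c_w w of the free algebra with the functional f ↦ ∑ c_w f(w) on integer-valued
-- test functions. Δ p = p ⊗ 1 + 1 ⊗ p then says that p takes the same value on w ↦ (coefficient of u ⊗ v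
-- in Δ w) as on w ↦ (coefficient of u ⊗ v in w ⊗ 1 + 1 ⊗ w), a statement that can be checked over ℤ.
-- Write x = β₁ and U = (γ_{α₁+σ(1)}, …, γ_{α₁+σ(ρ)}). Then w_{γ,σ̃_{k,s}} is x^{α₁-k} U₁⋯U_s x U_{s+1}⋯U_ρ x^{k-1}:
-- the transpositions τ_{k,s} move the last x of the leading block through U. Summing over s and σ gives
-- ∑_W ∑_{W = PS} (-1)^{|P|} C(ρ,|P|) P x S over the arrangements W of the letters of U, and Pascal's rule turns
-- this into (-1)^ρ times the sum of the iterated commutators [W_ρ,[…,[W₁,x]…]]. The sum over k is the closed
-- form of ad_x^{α₁-1}. Since x is primitive and commutators of primitive elements are primitive, so is P_γ.

open import Level using (Level)
open import Algebra.Bundles using (CommutativeRing)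
open import Data.Nat using (ℕ; zero; suc; _∸_; _≤_; _<_; z≤n; s≤s; _≤ᵇ_; _≡ᵇ_)
import Data.Nat.Properties as ℕ
open import Data.Nat.Combinatorics using (_C_)
open import Data.Fin as Fin using (Fin)
open import Data.List using (List; []; _∷_; _++_; _∷ʳ_; map; concatMap; replicate; applyUpTo; length; upTo; take; drop)
import Data.List.Properties as List
open import Data.List.Relation.Unary.All using (All; []; _∷_)
import Data.List.Relation.Unary.All as All
import Data.List.Relation.Unary.All.Properties as All
open import Data.Product using (_×_; _,_; proj₁; proj₂; map₁; map₂; uncurry)
open import Function using (_∘_)
open import Relation.Binary.PropositionalEquality as ≡ using (_≡_; _≢_)
open import Defs

module ListSum {c ℓ : Level} (R : CommutativeRing c ℓ) where
  open CommutativeRing R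
  open import Relation.Binary.Reasoning.Setoid setoid
  open import Algebra.Properties.CommutativeSemigroup +-commutativeSemigroup using (interchange)
  open import Algebra.Properties.Ring ring using (-‿+-comm; -0#≈0#)

  ∑ : {a : Level} {A : Set a} → List A → (A → Carrier) → Carrier
  ∑ []       f = 0#
  ∑ (x ∷ xs) f = f x + ∑ xs f

  syntax ∑ xs (λ x → e) = ∑[ x ∈ xs ] e

  module _ {a : Level} {A : Set a} where

    ∑-cong : ∀ (xs : List A) {f g : A → Carrier} → (∀ x → f x ≈ g x) → ∑ xs f ≈ ∑ xs g
    ∑-cong []       f≈g = refl
    ∑-cong (x ∷ xs) f≈g = +-cong (f≈g x) (∑-cong xs f≈g)

    ∑-congᴬ : ∀ {p} {P : A → Set p} {xs : List A} {f g : A → Carrier} →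
              All P xs → (∀ x → P x → f x ≈ g x) → ∑ xs f ≈ ∑ xs g
    ∑-congᴬ []         f≈g = refl
    ∑-congᴬ (px ∷ pxs) f≈g = +-cong (f≈g _ px) (∑-congᴬ pxs f≈g)

    ∑-zero : ∀ (xs : List A) {f : A → Carrier} → (∀ x → f x ≈ 0#) → ∑ xs f ≈ 0#
    ∑-zero xs f≈0 = trans (∑-cong xs f≈0) (∑-const-0 xs)
      where
      ∑-const-0 : ∀ xs → ∑ xs (λ _ → 0#) ≈ 0#
      ∑-const-0 []       = refl
      ∑-const-0 (_ ∷ xs) = trans (+-identityˡ _) (∑-const-0 xs)

    ∑-++ : ∀ (xs ys : List A) f → ∑ (xs ++ ys) f ≈ ∑ xs f + ∑ ys f
    ∑-++ []       ys f = sym (+-identityˡ _)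
    ∑-++ (x ∷ xs) ys f = trans (+-congˡ (∑-++ xs ys f)) (sym (+-assoc _ _ _))

    ∑-+ : ∀ (xs : List A) f g → ∑[ x ∈ xs ] (f x + g x) ≈ ∑ xs f + ∑ xs g
    ∑-+ []       f g = sym (+-identityˡ _)
    ∑-+ (x ∷ xs) f g = trans (+-congˡ (∑-+ xs f g)) (interchange _ _ _ _)

    ∑-neg : ∀ (xs : List A) f → ∑[ x ∈ xs ] (- f x) ≈ - ∑ xs f
    ∑-neg []       f = sym -0#≈0#
    ∑-neg (x ∷ xs) f = trans (+-congˡ (∑-neg xs f)) (-‿+-comm _ _)

    ∑-sub : ∀ (xs : List A) f g → ∑[ x ∈ xs ] (f x - g x) ≈ ∑ xs f - ∑ xs g
    ∑-sub xs f g = trans (∑-+ xs f (λ x → - g x)) (+-congˡ (∑-neg xs g))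

    ∑-*ˡ : ∀ (xs : List A) k f → ∑[ x ∈ xs ] (k * f x) ≈ k * ∑ xs f
    ∑-*ˡ []       k f = sym (zeroʳ k)
    ∑-*ˡ (x ∷ xs) k f = trans (+-congˡ (∑-*ˡ xs k f)) (sym (distribˡ k _ _))

  module _ {a b : Level} {A : Set a} {B : Set b} where

    ∑-map : ∀ (g : A → B) (xs : List A) f → ∑ (map g xs) f ≈ ∑[ x ∈ xs ] f (g x)
    ∑-map g []       f = refl
    ∑-map g (x ∷ xs) f = +-congˡ (∑-map g xs f)

    ∑-concatMap : ∀ (F : A → List B) (xs : List A) f → ∑ (concatMap F xs) f ≈ ∑[ x ∈ xs ] ∑ (F x) f
    ∑-concatMap F []       f = refl
    ∑-concatMap F (x ∷ xs) f = trans (∑-++ (F x) (concatMap F xs) f) (+-congˡ (∑-concatMap F xs f))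

    ∑-swap : ∀ (xs : List A) (ys : List B) (f : A → B → Carrier) →
             ∑[ x ∈ xs ] ∑[ y ∈ ys ] f x y ≈ ∑[ y ∈ ys ] ∑[ x ∈ xs ] f x y
    ∑-swap []       ys f = sym (∑-zero ys (λ _ → refl))
    ∑-swap (x ∷ xs) ys f = trans (+-congˡ (∑-swap xs ys f)) (sym (∑-+ ys (f x) _))


  ∑-upTo-suc : ∀ n f → ∑ (upTo (suc n)) f ≈ f 0 + ∑[ i ∈ upTo n ] f (suc i)
  ∑-upTo-suc n f = +-congˡ (trans (reflexive (≡.cong (λ l → ∑ l f) (≡.sym (List.map-upTo suc n)))) (∑-map suc (upTo n) f))

  ∑-upTo-∷ʳ : ∀ n f → ∑ (upTo (suc n)) f ≈ ∑ (upTo n) f + f n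
  ∑-upTo-∷ʳ n f = trans (reflexive (≡.cong (λ l → ∑ l f) (≡.sym (List.upTo-∷ʳ n))))
                        (trans (∑-++ (upTo n) (n ∷ []) f) (+-congˡ (+-identityʳ (f n))))

module Arrangements {A : Set} where

  picks : List A → List (A × List A)
  picks []      = []
  picks (a ∷ L) = (a , L) ∷ map (map₂ (a ∷_)) (picks L)

  arrangements : ℕ → List A → List (List A)
  arrangements zero    L = [] ∷ []
  arrangements (suc n) L = concatMap (uncurry λ x rest → map (x ∷_) (arrangements n rest)) (picks L)

  cuts : List A → List (List A × List A)
  cuts []      = ([] , []) ∷ []
  cuts (a ∷ W) = ([] , a ∷ W) ∷ map (map₁ (a ∷_)) (cuts W)

  pointedCuts : List A → List (List A × A × List A)
  pointedCuts []      = []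
  pointedCuts (a ∷ W) = ([] , a , W) ∷ map (map₁ (a ∷_)) (pointedCuts W)

  uncurry₃ : ∀ {b} {B : Set b} → (List A → A → List A → B) → List A × A × List A → B
  uncurry₃ g = uncurry λ P → uncurry (g P)

  length-arrangements : ∀ n L → All (λ W → length W ≡ n) (arrangements n L)
  length-arrangements zero    L = ≡.refl ∷ []
  length-arrangements (suc n) L =
    All.concat⁺ (All.map⁺ (All.universal (λ p → All.map⁺ (All.map (≡.cong suc) (length-arrangements n (proj₂ p)))) (picks L)))

  length-picks : ∀ L → All (λ p → suc (length (proj₂ p)) ≡ length L) (picks L)
  length-picks []      = []
  length-picks (a ∷ L) = ≡.refl ∷ All.map⁺ (All.map (≡.cong suc) (length-picks L))

  module Sums {c ℓ : Level} (R : CommutativeRing c ℓ) where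
    open CommutativeRing R hiding (zero)
    open ListSum R
    open import Relation.Binary.Reasoning.Setoid setoid
    open import Algebra.Properties.CommutativeSemigroup +-commutativeSemigroup using (x∙yz≈y∙xz)

    ∑-picks-∷ : ∀ a L (h : A → List A → Carrier) →
      ∑ (picks (a ∷ L)) (uncurry h) ≈ h a L + ∑ (picks L) (uncurry λ x rest → h x (a ∷ rest))
    ∑-picks-∷ a L h = +-congˡ (∑-map (map₂ (a ∷_)) (picks L) (uncurry h))

    ∑-arrangements-suc : ∀ n L (f : List A → Carrier) →
      ∑ (arrangements (suc n) L) f ≈ ∑ (picks L) (uncurry λ x rest → ∑[ V ∈ arrangements n rest ] f (x ∷ V))
    ∑-arrangements-suc n L f =
      trans (∑-concatMap _ (picks L) f) (∑-cong (picks L) λ p → ∑-map (proj₁ p ∷_) (arrangements n (proj₂ p)) f)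

    ∑-picks²-swap : ∀ L (F : A → A → List A → Carrier) →
      ∑ (picks L) (uncurry λ x rest → ∑ (picks rest) (uncurry (F x)))
      ≈ ∑ (picks L) (uncurry λ x rest → ∑ (picks rest) (uncurry λ y → F y x))
    ∑-picks²-swap []      F = refl
    ∑-picks²-swap (a ∷ L) F = begin
      ∑ (picks (a ∷ L)) (uncurry λ x rest → ∑ (picks rest) (uncurry (F x)))
        ≈⟨ expand F ⟩
      First F + (Second F + Rest F)
        ≈⟨ +-congˡ (+-congˡ (∑-picks²-swap L (λ x y rest → F x y (a ∷ rest)))) ⟩
      First F + (Second F + Rest (λ x y → F y x))
        ≈⟨ x∙yz≈y∙xz _ _ _ ⟩
      Second F + (First F + Rest (λ x y → F y x))
        ≈⟨ expand (λ x y → F y x) ⟨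
      ∑ (picks (a ∷ L)) (uncurry λ x rest → ∑ (picks rest) (uncurry λ y → F y x))
        ∎
      where
      First Second Rest : (A → A → List A → Carrier) → Carrier
      First  G = ∑ (picks L) (uncurry (G a))
      Second G = ∑ (picks L) (uncurry λ x rest → G x a rest)
      Rest   G = ∑ (picks L) (uncurry λ x rest → ∑ (picks rest) (uncurry λ y rest′ → G x y (a ∷ rest′)))
      expand : ∀ G → ∑ (picks (a ∷ L)) (uncurry λ x rest → ∑ (picks rest) (uncurry (G x))) ≈ First G + (Second G + Rest G)
      expand G = trans (∑-picks-∷ a L _)
        (+-congˡ (trans (∑-cong (picks L) λ p → ∑-picks-∷ a (proj₂ p) (G (proj₁ p))) (∑-+ (picks L) _ _)))

    ∑-cuts-∷ : ∀ a W (h : List A → List A → Carrier) →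
      ∑ (cuts (a ∷ W)) (uncurry h) ≈ h [] (a ∷ W) + ∑ (cuts W) (uncurry λ P S → h (a ∷ P) S)
    ∑-cuts-∷ a W h = +-congˡ (∑-map (map₁ (a ∷_)) (cuts W) (uncurry h))

    ∑-pointedCuts-∷ : ∀ a W (g : List A → A → List A → Carrier) →
      ∑ (pointedCuts (a ∷ W)) (uncurry₃ g) ≈ g [] a W + ∑ (pointedCuts W) (uncurry₃ λ P → g (a ∷ P))
    ∑-pointedCuts-∷ a W g = +-congˡ (∑-map (map₁ (a ∷_)) (pointedCuts W) (uncurry₃ g))

    ∑-cuts≈∑-pointedCutsʳ : ∀ W (h : List A → List A → Carrier) →
      ∑ (cuts W) (uncurry h) ≈ ∑ (pointedCuts W) (uncurry₃ λ P x S → h P (x ∷ S)) + h W []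
    ∑-cuts≈∑-pointedCutsʳ []      h = trans (+-identityʳ _) (sym (+-identityˡ _))
    ∑-cuts≈∑-pointedCutsʳ (a ∷ W) h = begin
      ∑ (cuts (a ∷ W)) (uncurry h)
        ≈⟨ ∑-cuts-∷ a W h ⟩
      h [] (a ∷ W) + ∑ (cuts W) (uncurry λ P S → h (a ∷ P) S)
        ≈⟨ +-congˡ (∑-cuts≈∑-pointedCutsʳ W (λ P → h (a ∷ P))) ⟩
      h [] (a ∷ W) + (∑ (pointedCuts W) (uncurry₃ λ P x S → h (a ∷ P) (x ∷ S)) + h (a ∷ W) [])
        ≈⟨ +-assoc _ _ _ ⟨
      (h [] (a ∷ W) + ∑ (pointedCuts W) (uncurry₃ λ P x S → h (a ∷ P) (x ∷ S))) + h (a ∷ W) []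
        ≈⟨ +-congʳ (∑-pointedCuts-∷ a W (λ P x S → h P (x ∷ S))) ⟨
      ∑ (pointedCuts (a ∷ W)) (uncurry₃ λ P x S → h P (x ∷ S)) + h (a ∷ W) []
        ∎

    ∑-cuts≈∑-pointedCutsˡ : ∀ W (h : List A → List A → Carrier) →
      ∑ (cuts W) (uncurry h) ≈ h [] W + ∑ (pointedCuts W) (uncurry₃ λ P x S → h (P ∷ʳ x) S)
    ∑-cuts≈∑-pointedCutsˡ []      h = refl
    ∑-cuts≈∑-pointedCutsˡ (a ∷ W) h = trans (∑-cuts-∷ a W h) (+-congˡ (trans
      (∑-cuts≈∑-pointedCutsˡ W (λ P → h (a ∷ P)))
      (sym (∑-pointedCuts-∷ a W (λ P x S → h (P ∷ʳ x) S)))))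

    -- Marking a position in an arrangement of n+1 letters is choosing the marked letter first
    -- and then an arrangement of the others, cut at the mark.
    ∑-arrangements-pointedCuts : ∀ n L (g : List A → A → List A → Carrier) →
      ∑[ W ∈ arrangements (suc n) L ] ∑ (pointedCuts W) (uncurry₃ g)
      ≈ ∑ (picks L) (uncurry λ x rest → ∑[ V ∈ arrangements n rest ] ∑ (cuts V) (uncurry λ P S → g P x S))
    ∑-arrangements-pointedCuts zero    L g = trans (∑-arrangements-suc zero L _) (∑-cong (picks L) λ _ → refl)
    ∑-arrangements-pointedCuts (suc n) L g = begin
      ∑[ W ∈ arrangements (suc (suc n)) L ] ∑ (pointedCuts W) (uncurry₃ g)
        ≈⟨ ∑-arrangements-suc (suc n) L _ ⟩
      ∑ (picks L) (uncurry λ x rest → ∑[ V ∈ arrangements (suc n) rest ] ∑ (pointedCuts (x ∷ V)) (uncurry₃ g))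
        ≈⟨ ∑-cong (picks L) (λ p → trans (∑-cong (arrangements (suc n) (proj₂ p)) λ V → ∑-pointedCuts-∷ (proj₁ p) V g)
                                         (∑-+ (arrangements (suc n) (proj₂ p)) _ _)) ⟩
      ∑ (picks L) (uncurry λ x rest → Front x rest + ∑[ V ∈ arrangements (suc n) rest ] ∑ (pointedCuts V) (uncurry₃ λ P → g (x ∷ P)))
        ≈⟨ ∑-cong (picks L) (λ p → +-congˡ (∑-arrangements-pointedCuts n (proj₂ p) (λ P → g (proj₁ p ∷ P)))) ⟩
      ∑ (picks L) (uncurry λ x rest → Front x rest + ∑ (picks rest) (uncurry (F x)))
        ≈⟨ ∑-+ (picks L) _ _ ⟩
      ∑ (picks L) (uncurry Front) + ∑ (picks L) (uncurry λ x rest → ∑ (picks rest) (uncurry (F x)))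
        ≈⟨ +-congˡ (∑-picks²-swap L F) ⟩
      ∑ (picks L) (uncurry Front) + ∑ (picks L) (uncurry λ x rest → ∑ (picks rest) (uncurry λ y → F y x))
        ≈⟨ ∑-+ (picks L) _ _ ⟨
      ∑ (picks L) (uncurry λ x rest → Front x rest + ∑ (picks rest) (uncurry λ y → F y x))
        ≈⟨ ∑-cong (picks L) (λ p → cutsOfArrangement (proj₁ p) (proj₂ p)) ⟨
      ∑ (picks L) (uncurry λ x rest → ∑[ V ∈ arrangements (suc n) rest ] ∑ (cuts V) (uncurry λ P S → g P x S))
        ∎
      where
      Front : A → List A → Carrier
      Front x rest = ∑[ V ∈ arrangements (suc n) rest ] g [] x V
      F : A → A → List A → Carrier
      F x y rest = ∑[ V ∈ arrangements n rest ] ∑ (cuts V) (uncurry λ P S → g (x ∷ P) y S)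
      cutsOfArrangement : ∀ x rest →
        ∑[ V ∈ arrangements (suc n) rest ] ∑ (cuts V) (uncurry λ P S → g P x S)
        ≈ Front x rest + ∑ (picks rest) (uncurry λ y → F y x)
      cutsOfArrangement x rest = begin
        ∑[ V ∈ arrangements (suc n) rest ] ∑ (cuts V) (uncurry λ P S → g P x S)
          ≈⟨ ∑-arrangements-suc n rest _ ⟩
        ∑ (picks rest) (uncurry λ y rest′ → ∑[ V ∈ arrangements n rest′ ] ∑ (cuts (y ∷ V)) (uncurry λ P S → g P x S))
          ≈⟨ ∑-cong (picks rest) (λ q → trans (∑-cong (arrangements n (proj₂ q)) λ V → ∑-cuts-∷ (proj₁ q) V _)
                                               (∑-+ (arrangements n (proj₂ q)) _ _)) ⟩
        ∑ (picks rest) (uncurry λ y rest′ → ∑[ V ∈ arrangements n rest′ ] g [] x (y ∷ V) + F y x rest′)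
          ≈⟨ ∑-+ (picks rest) _ _ ⟩
        ∑ (picks rest) (uncurry λ y rest′ → ∑[ V ∈ arrangements n rest′ ] g [] x (y ∷ V)) + ∑ (picks rest) (uncurry λ y → F y x)
          ≈⟨ +-congʳ (∑-arrangements-suc n rest (g [] x)) ⟨
        Front x rest + ∑ (picks rest) (uncurry λ y → F y x)
          ∎

    ∑-upTo≈∑-cuts : ∀ W (H : ℕ → List A → List A → Carrier) →
      ∑[ s ∈ upTo (suc (length W)) ] H s (take s W) (drop s W) ≈ ∑ (cuts W) (uncurry λ P S → H (length P) P S)
    ∑-upTo≈∑-cuts []      H = refl
    ∑-upTo≈∑-cuts (a ∷ W) H = trans (∑-upTo-suc (suc (length W)) _)
      (+-congˡ (trans (∑-upTo≈∑-cuts W (λ s P → H (suc s) (a ∷ P))) (sym (∑-map (map₁ (a ∷_)) (cuts W) _))))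

module Permutations where
  open import Relation.Binary.PropositionalEquality
  open ≡-Reasoning

  length-insertions : ∀ x (σ : List ℕ) → All (λ τ → length τ ≡ suc (length σ)) (insertions x σ)
  length-insertions x []      = refl ∷ []
  length-insertions x (y ∷ σ) = refl ∷ All.map⁺ (All.map (cong suc) (length-insertions x σ))

  length-perms : ∀ n → All (λ σ → length σ ≡ n) (perms n)
  length-perms zero    = refl ∷ []
  length-perms (suc n) = All.concat⁺ (All.map⁺
    (All.map (λ {σ} ∣σ∣≡n → All.map (λ ∣τ∣ → trans ∣τ∣ (cong suc ∣σ∣≡n)) (length-insertions (suc n) σ)) (length-perms n)))

  map-insertions : ∀ (g : ℕ → ℕ) x σ → map (map g) (insertions x σ) ≡ insertions (g x) (map g σ)
  map-insertions g x []      = refl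
  map-insertions g x (y ∷ σ) = cong ((g x ∷ g y ∷ map g σ) ∷_) (begin
    map (map g) (map (y ∷_) (insertions x σ))  ≡⟨ List.map-∘ (insertions x σ) ⟨
    map (λ τ → g y ∷ map g τ) (insertions x σ)  ≡⟨ List.map-∘ (insertions x σ) ⟩
    map (g y ∷_) (map (map g) (insertions x σ)) ≡⟨ cong (map (g y ∷_)) (map-insertions g x σ) ⟩
    map (g y ∷_) (insertions (g x) (map g σ))   ∎)

  oneTo-suc : ∀ n → oneTo (suc n) ≡ oneTo n ∷ʳ suc n
  oneTo-suc n = trans (cong (map suc) (sym (List.upTo-∷ʳ n))) (List.map-++ suc (upTo n) (n ∷ []))

module PermutationSums {c ℓ : Level} (R : CommutativeRing c ℓ) where
  open CommutativeRing R hiding (zero)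
  open ListSum R
  open Arrangements {ℕ}
  open Sums R
  open Permutations
  open import Relation.Binary.Reasoning.Setoid setoid

  ∑-picks-∷ʳ : ∀ L y (h : ℕ → List ℕ → Carrier) →
    ∑ (picks (L ∷ʳ y)) (uncurry h) ≈ ∑ (picks L) (uncurry λ x rest → h x (rest ∷ʳ y)) + h y L
  ∑-picks-∷ʳ []      y h = trans (+-identityʳ _) (sym (+-identityˡ _))
  ∑-picks-∷ʳ (a ∷ L) y h = begin
    ∑ (picks (a ∷ L ∷ʳ y)) (uncurry h)
      ≈⟨ ∑-picks-∷ a (L ∷ʳ y) h ⟩
    h a (L ∷ʳ y) + ∑ (picks (L ∷ʳ y)) (uncurry λ x rest → h x (a ∷ rest))
      ≈⟨ +-congˡ (∑-picks-∷ʳ L y (λ x rest → h x (a ∷ rest))) ⟩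
    h a (L ∷ʳ y) + (∑ (picks L) (uncurry λ x rest → h x (a ∷ rest ∷ʳ y)) + h y (a ∷ L))
      ≈⟨ +-assoc _ _ _ ⟨
    (h a (L ∷ʳ y) + ∑ (picks L) (uncurry λ x rest → h x (a ∷ rest ∷ʳ y))) + h y (a ∷ L)
      ≈⟨ +-congʳ (∑-picks-∷ a L (λ x rest → h x (rest ∷ʳ y))) ⟨
    ∑ (picks (a ∷ L)) (uncurry λ x rest → h x (rest ∷ʳ y)) + h y (a ∷ L) ∎

  ∑-arrangements-∷ʳ : ∀ n L y (F : List ℕ → Carrier) → length L ≡ n →
    ∑ (arrangements (suc n) (L ∷ʳ y)) F ≈ ∑[ W ∈ arrangements n L ] ∑ (insertions y W) F
  ∑-arrangements-∷ʳ zero    []      y F ≡.refl = sym (+-identityʳ _)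
  ∑-arrangements-∷ʳ (suc n) L       y F ∣L∣≡1+n = begin
    ∑ (arrangements (suc (suc n)) (L ∷ʳ y)) F
      ≈⟨ ∑-arrangements-suc (suc n) (L ∷ʳ y) F ⟩
    ∑ (picks (L ∷ʳ y)) (uncurry λ x rest → ∑[ V ∈ arrangements (suc n) rest ] F (x ∷ V))
      ≈⟨ ∑-picks-∷ʳ L y _ ⟩
    ∑ (picks L) (uncurry λ x rest → ∑[ V ∈ arrangements (suc n) (rest ∷ʳ y) ] F (x ∷ V))
      + ∑[ V ∈ arrangements (suc n) L ] F (y ∷ V)
      ≈⟨ +-cong (∑-congᴬ (length-picks L) λ p ∣p∣ →
                   ∑-arrangements-∷ʳ n (proj₂ p) y (λ V → F (proj₁ p ∷ V)) (ℕ.suc-injective (≡.trans ∣p∣ ∣L∣≡1+n)))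
                (∑-arrangements-suc n L (λ V → F (y ∷ V))) ⟩
    ∑ (picks L) (uncurry λ x rest → ∑[ W ∈ arrangements n rest ] ∑[ V ∈ insertions y W ] F (x ∷ V))
      + ∑ (picks L) (uncurry λ x rest → ∑[ W ∈ arrangements n rest ] F (y ∷ x ∷ W))
      ≈⟨ +-comm _ _ ⟩
    ∑ (picks L) (uncurry λ x rest → ∑[ W ∈ arrangements n rest ] F (y ∷ x ∷ W))
      + ∑ (picks L) (uncurry λ x rest → ∑[ W ∈ arrangements n rest ] ∑[ V ∈ insertions y W ] F (x ∷ V))
      ≈⟨ ∑-+ (picks L) _ _ ⟨
    ∑ (picks L) (uncurry λ x rest → ∑[ W ∈ arrangements n rest ] F (y ∷ x ∷ W)
                                   + ∑[ W ∈ arrangements n rest ] ∑[ V ∈ insertions y W ] F (x ∷ V))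
      ≈⟨ ∑-cong (picks L) (λ p → trans (∑-cong (arrangements n (proj₂ p)) λ W → +-congˡ (∑-map (proj₁ p ∷_) (insertions y W) F))
                                       (∑-+ (arrangements n (proj₂ p)) _ _)) ⟨
    ∑ (picks L) (uncurry λ x rest → ∑[ W ∈ arrangements n rest ] ∑ (insertions y (x ∷ W)) F)
      ≈⟨ ∑-arrangements-suc n L (λ W → ∑ (insertions y W) F) ⟨
    ∑[ W ∈ arrangements (suc n) L ] ∑ (insertions y W) F ∎

  ∑-perms : ∀ n (g : ℕ → ℕ) (F : List ℕ → Carrier) →
    ∑[ σ ∈ perms n ] F (map g σ) ≈ ∑ (arrangements n (map g (oneTo n))) F
  ∑-perms zero    g F = refl
  ∑-perms (suc n) g F = begin
    ∑[ σ ∈ concatMap (insertions (suc n)) (perms n) ] F (map g σ)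
      ≈⟨ ∑-concatMap (insertions (suc n)) (perms n) _ ⟩
    ∑[ σ ∈ perms n ] ∑[ τ ∈ insertions (suc n) σ ] F (map g τ)
      ≈⟨ ∑-cong (perms n) (λ σ → trans (sym (∑-map (map g) (insertions (suc n) σ) F))
                                      (reflexive (≡.cong (λ l → ∑ l F) (map-insertions g (suc n) σ)))) ⟩
    ∑[ σ ∈ perms n ] ∑ (insertions (g (suc n)) (map g σ)) F
      ≈⟨ ∑-perms n g (λ W → ∑ (insertions (g (suc n)) W) F) ⟩
    ∑[ W ∈ arrangements n (map g (oneTo n)) ] ∑ (insertions (g (suc n)) W) F
      ≈⟨ ∑-arrangements-∷ʳ n (map g (oneTo n)) (g (suc n)) F (length-map-oneTo n) ⟨
    ∑ (arrangements (suc n) (map g (oneTo n) ∷ʳ g (suc n))) F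
      ≈⟨ reflexive (≡.cong (λ l → ∑ (arrangements (suc n) l) F)
           (≡.sym (≡.trans (≡.cong (map g) (oneTo-suc n)) (List.map-++ g (oneTo n) (suc n ∷ []))))) ⟩
    ∑ (arrangements (suc n) (map g (oneTo (suc n)))) F ∎
    where
    length-map-oneTo : ∀ n → length (map g (oneTo n)) ≡ n
    length-map-oneTo n = ≡.trans (List.length-map g (oneTo n))
                           (≡.trans (List.length-map suc (upTo n)) (List.length-upTo n))

module Functionals where
  open import Data.Nat using () renaming (_+_ to _+ℕ_)
  open import Data.Nat.Combinatorics using (nCk+nC[k+1]≡[n+1]C[k+1]; k>n⇒nCk≡0)
  open import Data.Integer using (ℤ; +_; 0ℤ; 1ℤ; -_; _+_; _*_; _-_)
  import Data.Integer.Properties as ℤ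
  open import Data.Integer.Tactic.RingSolver using (solve-∀)
  open import Algebra.Properties.Ring ℤ.+-*-ring using (x[y-z]≈xy-xz; [y-z]x≈yx-zx)
  open import Relation.Binary.PropositionalEquality
  open ListSum ℤ.+-*-commutativeRing
  open Arrangements {ℕ}
  open Sums ℤ.+-*-commutativeRing

  -- In this encoding the product u Z v of words u, v and an element Z is λ f → Z (λ z → f (u ++ z ++ v)).
  Functional : Set
  Functional = (List ℕ → ℤ) → ℤ

  record IsLinear (F : Functional) : Set where
    field
      ext    : ∀ {f g} → (∀ w → f w ≡ g w) → F f ≡ F g
      +-homo : ∀ f g → F (λ w → f w + g w) ≡ F f + F g
      0-homo : F (λ _ → 0ℤ) ≡ 0ℤ

  ad : ℕ → Functional → Functional
  ad y Z f = Z (λ z → f (y ∷ z)) - Z (λ z → f (z ∷ʳ y))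

  sgnℤ : ℕ → ℤ
  sgnℤ = sgn ℤ.+-*-commutativeRing

  altBinom : ℕ → ℕ → ℤ
  altBinom n k = sgnℤ k * + (n C k)

  altBinom-suc : ∀ n k → altBinom (suc n) (suc k) ≡ altBinom n (suc k) - altBinom n k
  altBinom-suc n k = begin
    - s * + (suc n C suc k)             ≡⟨ cong (λ t → - s * + t) (nCk+nC[k+1]≡[n+1]C[k+1] n k) ⟨
    - s * + (n C k +ℕ n C suc k)        ≡⟨ cong (- s *_) (ℤ.pos-+ (n C k) (n C suc k)) ⟩
    - s * (+ (n C k) + + (n C suc k))   ≡⟨ solve-∀′ s (+ (n C k)) (+ (n C suc k)) ⟩
    - s * + (n C suc k) - s * + (n C k) ∎
    where
    open ≡-Reasoning
    s = sgnℤ k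
    solve-∀′ : ∀ s a b → - s * (a + b) ≡ - s * b - s * a
    solve-∀′ = solve-∀

  altBinom-vanishes : ∀ n → altBinom n (suc n) ≡ 0ℤ
  altBinom-vanishes n = trans (cong (λ t → sgnℤ (suc n) * + t) (k>n⇒nCk≡0 (ℕ.n<1+n n))) (ℤ.*-zeroʳ (sgnℤ (suc n)))

  altBinom-suc-* : ∀ n k y → altBinom (suc n) (suc k) * y ≡ altBinom n (suc k) * y - altBinom n k * y
  altBinom-suc-* n k y = trans (cong (_* y) (altBinom-suc n k)) ([y-z]x≈yx-zx y (altBinom n (suc k)) (altBinom n k))

  ∑-cuts-pascal : ∀ n W → length W ≡ suc n → (X : List ℕ → List ℕ → ℤ) →
    ∑ (cuts W) (uncurry λ P S → altBinom (suc n) (length P) * X P S)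
    ≡ ∑ (pointedCuts W) (uncurry₃ λ P x S → altBinom n (length P) * X P (x ∷ S))
      - ∑ (pointedCuts W) (uncurry₃ λ P x S → altBinom n (length P) * X (P ∷ʳ x) S)
  ∑-cuts-pascal n W ∣W∣≡1+n X = begin
    ∑ (cuts W) (uncurry λ P S → altBinom (suc n) (length P) * X P S)
      ≡⟨ ∑-cuts≈∑-pointedCutsˡ W _ ⟩
    X₀ + ∑ (pointedCuts W) (uncurry₃ λ P x S → altBinom (suc n) (length (P ∷ʳ x)) * X (P ∷ʳ x) S)
      ≡⟨ cong (λ t → X₀ + t) (∑-cong (pointedCuts W) (λ c → pascal (proj₁ c) (proj₁ (proj₂ c)) (proj₂ (proj₂ c)))) ⟩
    X₀ + ∑ (pointedCuts W) (uncurry₃ λ P x S → altBinom n (length (P ∷ʳ x)) * X (P ∷ʳ x) S - altBinom n (length P) * X (P ∷ʳ x) S)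
      ≡⟨ cong (λ t → X₀ + t) (∑-sub (pointedCuts W) _ _) ⟩
    X₀ + (∑ (pointedCuts W) (uncurry₃ λ P x S → altBinom n (length (P ∷ʳ x)) * X (P ∷ʳ x) S) - Removed)
      ≡⟨ ℤ.+-assoc X₀ _ (- Removed) ⟨
    X₀ + ∑ (pointedCuts W) (uncurry₃ λ P x S → altBinom n (length (P ∷ʳ x)) * X (P ∷ʳ x) S) - Removed
      ≡⟨ cong (_- Removed) (∑-cuts≈∑-pointedCutsˡ W _) ⟨
    ∑ (cuts W) (uncurry λ P S → altBinom n (length P) * X P S) - Removed
      ≡⟨ cong (_- Removed) (∑-cuts≈∑-pointedCutsʳ W _) ⟩
    Kept + altBinom n (length W) * X W [] - Removed
      ≡⟨ cong (λ k → Kept + altBinom n k * X W [] - Removed) ∣W∣≡1+n ⟩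
    Kept + altBinom n (suc n) * X W [] - Removed
      ≡⟨ cong (λ t → Kept + t * X W [] - Removed) (altBinom-vanishes n) ⟩
    Kept + 0ℤ - Removed
      ≡⟨ cong (_- Removed) (ℤ.+-identityʳ Kept) ⟩
    Kept - Removed ∎
    where
    open ≡-Reasoning
    X₀ = altBinom n 0 * X [] W
    Kept    = ∑ (pointedCuts W) (uncurry₃ λ P x S → altBinom n (length P) * X P (x ∷ S))
    Removed = ∑ (pointedCuts W) (uncurry₃ λ P x S → altBinom n (length P) * X (P ∷ʳ x) S)
    pascal : ∀ P x S → altBinom (suc n) (length (P ∷ʳ x)) * X (P ∷ʳ x) S
                     ≡ altBinom n (length (P ∷ʳ x)) * X (P ∷ʳ x) S - altBinom n (length P) * X (P ∷ʳ x) S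
    pascal P x S rewrite List.length-++ P {x ∷ []} | ℕ.+-comm (length P) 1 = altBinom-suc-* n (length P) (X (P ∷ʳ x) S)

  bracketSum : ℕ → List ℕ → Functional → Functional
  bracketSum n L Z f =
    ∑[ W ∈ arrangements n L ] ∑ (cuts W) (uncurry λ P S → altBinom n (length P) * Z (λ z → f (P ++ z ++ S)))

  bracketSum-suc : ∀ n L Z → IsLinear Z → ∀ f →
    bracketSum (suc n) L Z f ≡ - ∑ (picks L) (uncurry λ y rest → bracketSum n rest (ad y Z) f)
  bracketSum-suc n L Z lin f = begin
    bracketSum (suc n) L Z f
      ≡⟨ ∑-congᴬ (length-arrangements (suc n) L) (λ W ∣W∣≡1+n → ∑-cuts-pascal n W ∣W∣≡1+n X) ⟩
    ∑[ W ∈ arrangements (suc n) L ] (∑ (pointedCuts W) (uncurry₃ g⁺) - ∑ (pointedCuts W) (uncurry₃ g⁻))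
      ≡⟨ ∑-sub (arrangements (suc n) L) _ _ ⟩
    ∑[ W ∈ arrangements (suc n) L ] ∑ (pointedCuts W) (uncurry₃ g⁺)
      - ∑[ W ∈ arrangements (suc n) L ] ∑ (pointedCuts W) (uncurry₃ g⁻)
      ≡⟨ cong₂ _-_ (∑-arrangements-pointedCuts n L g⁺) (∑-arrangements-pointedCuts n L g⁻) ⟩
    ∑ (picks L) (uncurry (Cut g⁺)) - ∑ (picks L) (uncurry (Cut g⁻))
      ≡⟨ a-b≡-[b-a] (∑ (picks L) (uncurry (Cut g⁺))) (∑ (picks L) (uncurry (Cut g⁻))) ⟩
    - (∑ (picks L) (uncurry (Cut g⁻)) - ∑ (picks L) (uncurry (Cut g⁺)))
      ≡⟨ cong -_ (∑-sub (picks L) _ _) ⟨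
    - ∑ (picks L) (uncurry λ y rest → Cut g⁻ y rest - Cut g⁺ y rest)
      ≡⟨ cong -_ (∑-cong (picks L) λ p → bracketSum-ad (proj₁ p) (proj₂ p)) ⟨
    - ∑ (picks L) (uncurry λ y rest → bracketSum n rest (ad y Z) f) ∎
    where
    open ≡-Reasoning
    open IsLinear lin
    X : List ℕ → List ℕ → ℤ
    X P S = Z (λ z → f (P ++ z ++ S))
    g⁺ g⁻ : List ℕ → ℕ → List ℕ → ℤ
    g⁺ P x S = altBinom n (length P) * X P (x ∷ S)
    g⁻ P x S = altBinom n (length P) * X (P ∷ʳ x) S
    Cut : (List ℕ → ℕ → List ℕ → ℤ) → ℕ → List ℕ → ℤ
    Cut g y rest = ∑[ V ∈ arrangements n rest ] ∑ (cuts V) (uncurry λ P S → g P y S)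
    a-b≡-[b-a] : ∀ a b → a - b ≡ - (b - a)
    a-b≡-[b-a] = solve-∀
    ad-term : ∀ y P S → altBinom n (length P) * ad y Z (λ z → f (P ++ z ++ S)) ≡ g⁻ P y S - g⁺ P y S
    ad-term y P S = trans (x[y-z]≈xy-xz (altBinom n (length P)) _ _) (cong₂ (λ a b → altBinom n (length P) * a - altBinom n (length P) * b)
      (ext λ z → cong f (sym (List.∷ʳ-++ P y (z ++ S))))
      (ext λ z → cong (λ t → f (P ++ t)) (List.∷ʳ-++ z y S)))
    bracketSum-ad : ∀ y rest → bracketSum n rest (ad y Z) f ≡ Cut g⁻ y rest - Cut g⁺ y rest
    bracketSum-ad y rest = trans
      (∑-cong (arrangements n rest) λ V → trans (∑-cong (cuts V) λ c → ad-term y (proj₁ c) (proj₂ c)) (∑-sub (cuts V) _ _))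
      (∑-sub (arrangements n rest) _ _)

  ad-linear : ∀ y {Z} → IsLinear Z → IsLinear (ad y Z)
  ad-linear y {Z} lin = record
    { ext    = λ f≗g → cong₂ _-_ (ext λ z → f≗g (y ∷ z)) (ext λ z → f≗g (z ∷ʳ y))
    ; +-homo = λ f g → trans (cong₂ _-_ (+-homo (λ z → f (y ∷ z)) (λ z → g (y ∷ z))) (+-homo (λ z → f (z ∷ʳ y)) (λ z → g (z ∷ʳ y))))
                               (+-minus-interchange (Z (λ z → f (y ∷ z))) (Z (λ z → g (y ∷ z))) (Z (λ z → f (z ∷ʳ y))) (Z (λ z → g (z ∷ʳ y))))
    ; 0-homo = cong₂ _-_ 0-homo 0-homo
    }
    where
    open IsLinear lin
    +-minus-interchange : ∀ a b c d → (a + b) - (c + d) ≡ (a - c) + (b - d)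
    +-minus-interchange = solve-∀

  bracketSum-linear : ∀ n L {Z} → IsLinear Z → IsLinear (bracketSum n L Z)
  bracketSum-linear n L lin = record
    { ext    = λ f≗g → ∑-cong (arrangements n L) λ W → ∑-cong (cuts W) λ c →
                 cong (altBinom n (length (proj₁ c)) *_) (ext λ z → f≗g _)
    ; +-homo = λ f g → trans
                 (∑-cong (arrangements n L) λ W → trans
                   (∑-cong (cuts W) λ c → trans (cong (altBinom n (length (proj₁ c)) *_) (+-homo _ _))
                                                (ℤ.*-distribˡ-+ (altBinom n (length (proj₁ c))) _ _))
                   (∑-+ (cuts W) _ _))
                 (∑-+ (arrangements n L) _ _)
    ; 0-homo = ∑-zero (arrangements n L) λ W → ∑-zero (cuts W) λ c →
                 trans (cong (altBinom n (length (proj₁ c)) *_) 0-homo) (ℤ.*-zeroʳ (altBinom n (length (proj₁ c))))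
    }
    where open IsLinear lin

  bracketSum-zero : ∀ L {Z} → IsLinear Z → ∀ f → bracketSum 0 L Z f ≡ Z f
  bracketSum-zero L {Z} lin f = begin
    (1ℤ * Z (λ z → f (z ++ [])) + 0ℤ) + 0ℤ ≡⟨ ℤ.+-identityʳ _ ⟩
    1ℤ * Z (λ z → f (z ++ [])) + 0ℤ        ≡⟨ ℤ.+-identityʳ _ ⟩
    1ℤ * Z (λ z → f (z ++ []))              ≡⟨ ℤ.*-identityˡ _ ⟩
    Z (λ z → f (z ++ []))                   ≡⟨ IsLinear.ext lin (λ z → cong f (List.++-identityʳ z)) ⟩
    Z f                                     ∎
    where open ≡-Reasoning

  letter : ℕ → Functional
  letter x f = f (x ∷ [])

  letter-linear : ∀ x → IsLinear (letter x)
  letter-linear x = record { ext = λ f≗g → f≗g (x ∷ []) ; +-homo = λ _ _ → refl ; 0-homo = refl }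

  adPow : ℕ → ℕ → Functional → Functional
  adPow x zero    Z = Z
  adPow x (suc m) Z = ad x (adPow x m Z)

  adPow-linear : ∀ x m {Z} → IsLinear Z → IsLinear (adPow x m Z)
  adPow-linear x zero    lin = lin
  adPow-linear x (suc m) lin = ad-linear x (adPow-linear x m lin)

  replicate-∷ʳ : ∀ {A : Set} n (x : A) → replicate n x ∷ʳ x ≡ x ∷ replicate n x
  replicate-∷ʳ zero    x = refl
  replicate-∷ʳ (suc n) x = cong (x ∷_) (replicate-∷ʳ n x)

  ∑-altBinom-pascal : ∀ m (H : ℕ → ℤ) →
    ∑[ b ∈ upTo (suc m) ] (altBinom m b * H b) - ∑[ b ∈ upTo (suc m) ] (altBinom m b * H (suc b))
    ≡ ∑[ b ∈ upTo (suc (suc m)) ] (altBinom (suc m) b * H b)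
  ∑-altBinom-pascal m H = begin
    ∑[ b ∈ upTo (suc m) ] (altBinom m b * H b) - Shifted
      ≡⟨ cong (_- Shifted) (∑-upTo-suc m (λ b → altBinom m b * H b)) ⟩
    altBinom m 0 * H 0 + ∑[ b ∈ upTo m ] (altBinom m (suc b) * H (suc b)) - Shifted
      ≡⟨ cong (λ t → altBinom m 0 * H 0 + t - Shifted) topTermVanishes ⟨
    altBinom m 0 * H 0 + ∑[ b ∈ upTo (suc m) ] (altBinom m (suc b) * H (suc b)) - Shifted
      ≡⟨ ℤ.+-assoc (altBinom m 0 * H 0) _ (- Shifted) ⟩
    altBinom m 0 * H 0 + (∑[ b ∈ upTo (suc m) ] (altBinom m (suc b) * H (suc b)) - Shifted)
      ≡⟨ cong (λ t → altBinom m 0 * H 0 + t) (∑-sub (upTo (suc m)) (λ b → altBinom m (suc b) * H (suc b)) (λ b → altBinom m b * H (suc b))) ⟨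
    altBinom (suc m) 0 * H 0 + ∑[ b ∈ upTo (suc m) ] (altBinom m (suc b) * H (suc b) - altBinom m b * H (suc b))
      ≡⟨ cong (λ t → altBinom m 0 * H 0 + t) (∑-cong (upTo (suc m)) λ b → altBinom-suc-* m b (H (suc b))) ⟨
    altBinom (suc m) 0 * H 0 + ∑[ b ∈ upTo (suc m) ] (altBinom (suc m) (suc b) * H (suc b))
      ≡⟨ ∑-upTo-suc (suc m) (λ b → altBinom (suc m) b * H b) ⟨
    ∑[ b ∈ upTo (suc (suc m)) ] (altBinom (suc m) b * H b) ∎
    where
    open ≡-Reasoning
    Shifted = ∑[ b ∈ upTo (suc m) ] (altBinom m b * H (suc b))
    topTermVanishes : ∑[ b ∈ upTo (suc m) ] (altBinom m (suc b) * H (suc b)) ≡ ∑[ b ∈ upTo m ] (altBinom m (suc b) * H (suc b))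
    topTermVanishes = trans (∑-upTo-∷ʳ m (λ b → altBinom m (suc b) * H (suc b)))
      (trans (cong (λ t → ∑[ b ∈ upTo m ] (altBinom m (suc b) * H (suc b)) + t * H (suc m)) (altBinom-vanishes m)) (ℤ.+-identityʳ _))

  adPow-closed : ∀ x m Z → IsLinear Z → ∀ f →
    adPow x m Z f ≡ ∑[ b ∈ upTo (suc m) ] (altBinom m b * Z (λ z → f (replicate (m ∸ b) x ++ z ++ replicate b x)))
  adPow-closed x zero    Z lin f =
    sym (trans (ℤ.+-identityʳ _) (trans (ℤ.*-identityˡ _) (IsLinear.ext lin λ z → cong f (List.++-identityʳ z))))
  adPow-closed x (suc m) Z lin f = begin
    adPow x m Z (λ w → f (x ∷ w)) - adPow x m Z (λ w → f (w ∷ʳ x))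
      ≡⟨ cong₂ _-_ (adPow-closed x m Z lin _) (adPow-closed x m Z lin _) ⟩
    ∑[ b ∈ upTo (suc m) ] (altBinom m b * Z (λ z → f (x ∷ replicate (m ∸ b) x ++ z ++ replicate b x)))
      - ∑[ b ∈ upTo (suc m) ] (altBinom m b * Z (λ z → f ((replicate (m ∸ b) x ++ z ++ replicate b x) ∷ʳ x)))
      ≡⟨ cong₂ _-_ (∑-congᴬ (All.all-upTo (suc m)) λ b b<1+m → cong (altBinom m b *_) (ext λ z → cong f (growLeft b<1+m z)))
                   (∑-cong (upTo (suc m)) λ b → cong (altBinom m b *_) (ext λ z → cong f (growRight b z))) ⟩
    ∑[ b ∈ upTo (suc m) ] (altBinom m b * H b) - ∑[ b ∈ upTo (suc m) ] (altBinom m b * H (suc b))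
      ≡⟨ ∑-altBinom-pascal m H ⟩
    ∑[ b ∈ upTo (suc (suc m)) ] (altBinom (suc m) b * H b) ∎
    where
    open ≡-Reasoning
    open IsLinear lin
    H : ℕ → ℤ
    H b = Z (λ z → f (replicate (suc m ∸ b) x ++ z ++ replicate b x))
    growLeft : ∀ {b} → b < suc m → ∀ z →
      x ∷ replicate (m ∸ b) x ++ z ++ replicate b x ≡ replicate (suc m ∸ b) x ++ z ++ replicate b x
    growLeft {b} b<1+m z = cong (λ k → replicate k x ++ z ++ replicate b x) (sym (ℕ.+-∸-assoc 1 (ℕ.≤-pred b<1+m)))
    growRight : ∀ b z →
      (replicate (m ∸ b) x ++ z ++ replicate b x) ∷ʳ x ≡ replicate (m ∸ b) x ++ z ++ replicate (suc b) x
    growRight b z = begin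
      (replicate (m ∸ b) x ++ z ++ replicate b x) ∷ʳ x ≡⟨ List.++-assoc (replicate (m ∸ b) x) (z ++ replicate b x) (x ∷ []) ⟩
      replicate (m ∸ b) x ++ (z ++ replicate b x) ∷ʳ x ≡⟨ cong (replicate (m ∸ b) x ++_) (List.++-assoc z (replicate b x) (x ∷ [])) ⟩
      replicate (m ∸ b) x ++ z ++ replicate b x ∷ʳ x   ≡⟨ cong (λ r → replicate (m ∸ b) x ++ z ++ r) (replicate-∷ʳ b x) ⟩
      replicate (m ∸ b) x ++ z ++ replicate (suc b) x  ∎

module Primitivity where
  open import Data.Bool using (Bool; true; false)
  open import Data.Integer using (ℤ; 0ℤ; 1ℤ; -_; _+_; _-_; _*_)
  import Data.Integer.Properties as ℤ
  open import Data.Integer.Tactic.RingSolver using (solve-∀)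
  open import Relation.Binary.PropositionalEquality
  open ListSum ℤ.+-*-commutativeRing
  open Arrangements {ℕ}
  open Functionals

  when : Bool → ℤ → ℤ
  when true  t = t
  when false t = 0ℤ

  when-0 : ∀ c → when c 0ℤ ≡ 0ℤ
  when-0 true  = refl
  when-0 false = refl

  when-+ : ∀ c s t → when c (s + t) ≡ when c s + when c t
  when-+ true  s t = refl
  when-+ false s t = refl

  whenHead : ℕ → (List ℕ → ℤ) → List ℕ → ℤ
  whenHead a k []      = 0ℤ
  whenHead a k (b ∷ u) = when (a ≡ᵇ b) (k u)

  -- whenLast x k (u ∷ʳ c) = when (x ≡ᵇ c) (k u)
  whenLast : ℕ → (List ℕ → ℤ) → List ℕ → ℤ
  whenLast x k []          = 0ℤ
  whenLast x k (c ∷ [])    = when (x ≡ᵇ c) (k [])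
  whenLast x k (c ∷ d ∷ u) = whenLast x (λ u′ → k (c ∷ u′)) (d ∷ u)

  whenHead-cong : ∀ a {k k′} → (∀ u → k u ≡ k′ u) → ∀ u → whenHead a k u ≡ whenHead a k′ u
  whenHead-cong a k≗k′ []      = refl
  whenHead-cong a k≗k′ (b ∷ u) = cong (when (a ≡ᵇ b)) (k≗k′ u)

  whenHead-+ : ∀ a k k′ u → whenHead a (λ u′ → k u′ + k′ u′) u ≡ whenHead a k u + whenHead a k′ u
  whenHead-+ a k k′ []      = refl
  whenHead-+ a k k′ (b ∷ u) = when-+ (a ≡ᵇ b) (k u) (k′ u)

  whenLast-0 : ∀ x {k} → (∀ u → k u ≡ 0ℤ) → ∀ u → whenLast x k u ≡ 0ℤ
  whenLast-0 x k≗0 []          = refl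
  whenLast-0 x k≗0 (c ∷ [])    = trans (cong (when (x ≡ᵇ c)) (k≗0 [])) (when-0 _)
  whenLast-0 x k≗0 (c ∷ d ∷ u) = whenLast-0 x (λ u′ → k≗0 (c ∷ u′)) (d ∷ u)

  whenLast-+ : ∀ x k k′ u → whenLast x (λ u′ → k u′ + k′ u′) u ≡ whenLast x k u + whenLast x k′ u
  whenLast-+ x k k′ []          = refl
  whenLast-+ x k k′ (c ∷ [])    = when-+ (x ≡ᵇ c) (k []) (k′ [])
  whenLast-+ x k k′ (c ∷ d ∷ u) = whenLast-+ x (λ u′ → k (c ∷ u′)) (λ u′ → k′ (c ∷ u′)) (d ∷ u)

  whenLast-when : ∀ x c k u → whenLast x (λ u′ → when c (k u′)) u ≡ when c (whenLast x k u)
  whenLast-when x true  k u = refl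
  whenLast-when x false k u = whenLast-0 x (λ _ → refl) u

  whenLast-whenHead : ∀ x a k u → whenLast x (whenHead a k) u ≡ whenHead a (whenLast x k) u
  whenLast-whenHead x a k []          = refl
  whenLast-whenHead x a k (b ∷ [])    = trans (when-0 _) (sym (when-0 _))
  whenLast-whenHead x a k (b ∷ d ∷ u) = whenLast-when x (a ≡ᵇ b) k (d ∷ u)

  whenLast-whenHead-apart : ∀ x a (K : List ℕ → List ℕ → ℤ) u v →
    whenLast x (λ u′ → whenHead a (K u′) v) u ≡ whenHead a (λ v′ → whenLast x (λ u′ → K u′ v′) u) v
  whenLast-whenHead-apart x a K u []      = whenLast-0 x (λ _ → refl) u
  whenLast-whenHead-apart x a K u (b ∷ v) = whenLast-when x (a ≡ᵇ b) (λ u′ → K u′ v) u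

  -- Under the hypothesis only one-letter words contribute, and there the first letter is the last.
  whenLast≡whenHead : ∀ x {k} → (∀ c r → k (c ∷ r) ≡ 0ℤ) → ∀ u → whenLast x k u ≡ whenHead x k u
  whenLast≡whenHead x k-vanishes []          = refl
  whenLast≡whenHead x k-vanishes (c ∷ [])    = refl
  whenLast≡whenHead x k-vanishes (c ∷ d ∷ u) =
    trans (whenLast-0 x (k-vanishes c) (d ∷ u)) (sym (trans (cong (when (x ≡ᵇ c)) (k-vanishes d u)) (when-0 _)))

  δ : List ℕ → List ℕ → ℤ
  δ []      []      = 1ℤ
  δ []      (_ ∷ _) = 0ℤ
  δ (a ∷ w) v       = whenHead a (δ w) v

  -- splitCount w u v is the coefficient of u ⊗ v in Δ w.
  splitCount : List ℕ → List ℕ → List ℕ → ℤ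
  splitCount []      []      []      = 1ℤ
  splitCount []      []      (_ ∷ _) = 0ℤ
  splitCount []      (_ ∷ _) _       = 0ℤ
  splitCount (a ∷ w) u       v       = whenHead a (λ u′ → splitCount w u′ v) u + whenHead a (splitCount w u) v

  splitCount-[]ˡ : ∀ w v → splitCount w [] v ≡ δ w v
  splitCount-[]ˡ []      []      = refl
  splitCount-[]ˡ []      (_ ∷ _) = refl
  splitCount-[]ˡ (a ∷ w) v       = trans (ℤ.+-identityˡ _) (whenHead-cong a (splitCount-[]ˡ w) v)

  splitCount-[]ʳ : ∀ w u → splitCount w u [] ≡ δ w u
  splitCount-[]ʳ []      []      = refl
  splitCount-[]ʳ []      (_ ∷ _) = refl
  splitCount-[]ʳ (a ∷ w) u       = trans (ℤ.+-identityʳ _) (whenHead-cong a (λ u′ → splitCount-[]ʳ w u′) u)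

  splitCount-[]-∷ : ∀ u b v → splitCount [] u (b ∷ v) ≡ 0ℤ
  splitCount-[]-∷ []      b v = refl
  splitCount-[]-∷ (_ ∷ _) b v = refl

  splitCount-∷ʳ : ∀ w x u v →
    splitCount (w ∷ʳ x) u v ≡ whenLast x (λ u′ → splitCount w u′ v) u + whenLast x (splitCount w u) v
  splitCount-∷ʳ []      x u v = sym (cong₂ _+_
    (whenLast≡whenHead x (λ _ _ → refl) u)
    (whenLast≡whenHead x (λ c r → splitCount-[]-∷ u c r) v))
  splitCount-∷ʳ (a ∷ w) x u v = begin
    whenHead a (λ u′ → splitCount (w ∷ʳ x) u′ v) u + whenHead a (splitCount (w ∷ʳ x) u) v
      ≡⟨ cong₂ _+_ (trans (whenHead-cong a (λ u′ → splitCount-∷ʳ w x u′ v) u) (whenHead-+ a _ _ u))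
                   (trans (whenHead-cong a (splitCount-∷ʳ w x u) v) (whenHead-+ a _ _ v)) ⟩
    (whenHead a (λ u′ → Lˡ u′ v) u + whenHead a (λ u′ → Lʳ u′ v) u) + (whenHead a (Lˡ u) v + whenHead a (Lʳ u) v)
      ≡⟨ interchange (whenHead a (λ u′ → Lˡ u′ v) u) (whenHead a (λ u′ → Lʳ u′ v) u) (whenHead a (Lˡ u) v) (whenHead a (Lʳ u) v) ⟩
    (whenHead a (λ u′ → Lˡ u′ v) u + whenHead a (Lˡ u) v) + (whenHead a (λ u′ → Lʳ u′ v) u + whenHead a (Lʳ u) v)
      ≡⟨ cong₂ _+_
           (trans (whenLast-+ x _ _ u) (cong₂ _+_ (whenLast-whenHead x a _ u) (whenLast-whenHead-apart x a (splitCount w) u v)))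
           (trans (whenLast-+ x _ _ v) (cong₂ _+_ (whenLast-whenHead-apart x a (λ v′ u′ → splitCount w u′ v′) v u)
                                                (whenLast-whenHead x a _ v))) ⟨
    whenLast x (λ u′ → splitCount (a ∷ w) u′ v) u + whenLast x (splitCount (a ∷ w) u) v ∎
    where
    open ≡-Reasoning
    Lˡ Lʳ : List ℕ → List ℕ → ℤ
    Lˡ u′ v′ = whenLast x (λ u″ → splitCount w u″ v′) u′
    Lʳ u′ v′ = whenLast x (splitCount w u′) v′
    interchange : ∀ p q r s → (p + q) + (r + s) ≡ (p + r) + (q + s)
    interchange = solve-∀

  trivialSplitCount : List ℕ → List ℕ → List ℕ → ℤ
  trivialSplitCount w u v = δ w u * δ [] v + δ [] u * δ w v

  IsPrimitive : Functional → Set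
  IsPrimitive F = ∀ a u b v → F (λ w → splitCount w (a ∷ u) (b ∷ v)) ≡ 0ℤ

  module _ {F : Functional} (lin : IsLinear F) where
    open IsLinear lin

    F-when : ∀ c h → F (λ w → when c (h w)) ≡ when c (F h)
    F-when true  h = refl
    F-when false h = 0-homo

    F-whenLast : ∀ x (k : List ℕ → List ℕ → ℤ) u → F (λ w → whenLast x (k w) u) ≡ whenLast x (λ u′ → F (λ w → k w u′)) u
    F-whenLast x k []          = 0-homo
    F-whenLast x k (c ∷ [])    = F-when (x ≡ᵇ c) (λ w → k w [])
    F-whenLast x k (c ∷ d ∷ u) = F-whenLast x (λ w u′ → k w (c ∷ u′)) (d ∷ u)

    ad-primitive : IsPrimitive F → ∀ x → IsPrimitive (ad x F)
    ad-primitive F-prim x a u b v = begin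
      F (λ z → when (x ≡ᵇ a) (Kˡ-at z u) + when (x ≡ᵇ b) (Kʳ-at z v)) - F (λ z → splitCount (z ∷ʳ x) (a ∷ u) (b ∷ v))
        ≡⟨ cong₂ _-_ (trans (+-homo _ _) (cong₂ _+_ (F-when (x ≡ᵇ a) _) (F-when (x ≡ᵇ b) _)))
                     (trans (ext λ z → splitCount-∷ʳ z x (a ∷ u) (b ∷ v))
                       (trans (+-homo _ _) (cong₂ _+_ (F-whenLast x Kˡ-at (a ∷ u)) (F-whenLast x Kʳ-at (b ∷ v))))) ⟩
      (when (x ≡ᵇ a) (Kˡ u) + when (x ≡ᵇ b) (Kʳ v)) - (whenLast x Kˡ (a ∷ u) + whenLast x Kʳ (b ∷ v))
        ≡⟨ cong (λ t → (when (x ≡ᵇ a) (Kˡ u) + when (x ≡ᵇ b) (Kʳ v)) - t)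
                (cong₂ _+_ (whenLast≡whenHead x (λ c r → F-prim c r b v) (a ∷ u))
                           (whenLast≡whenHead x (λ c r → F-prim a u c r) (b ∷ v))) ⟩
      (when (x ≡ᵇ a) (Kˡ u) + when (x ≡ᵇ b) (Kʳ v)) - (when (x ≡ᵇ a) (Kˡ u) + when (x ≡ᵇ b) (Kʳ v))
        ≡⟨ ℤ.+-inverseʳ (when (x ≡ᵇ a) (Kˡ u) + when (x ≡ᵇ b) (Kʳ v)) ⟩
      0ℤ ∎
      where
      open ≡-Reasoning
      Kˡ-at Kʳ-at : List ℕ → List ℕ → ℤ
      Kˡ-at z u′ = splitCount z u′ (b ∷ v)
      Kʳ-at z v′ = splitCount z (a ∷ u) v′
      Kˡ Kʳ : List ℕ → ℤ
      Kˡ u′ = F (λ z → Kˡ-at z u′)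
      Kʳ v′ = F (λ z → Kʳ-at z v′)

  adPow-primitive : ∀ x m {Z} → IsLinear Z → IsPrimitive Z → IsPrimitive (adPow x m Z)
  adPow-primitive x zero    lin Z-prim = Z-prim
  adPow-primitive x (suc m) lin Z-prim = ad-primitive (adPow-linear x m lin) (adPow-primitive x m lin Z-prim) x

  bracketSum-primitive : ∀ n L {Z} → IsLinear Z → IsPrimitive Z → IsPrimitive (bracketSum n L Z)
  bracketSum-primitive zero    L lin Z-prim a u b v = trans (bracketSum-zero L lin _) (Z-prim a u b v)
  bracketSum-primitive (suc n) L lin Z-prim a u b v = trans (bracketSum-suc n L _ lin (λ w → splitCount w (a ∷ u) (b ∷ v))) (cong -_
    (∑-zero (picks L) λ p →
      bracketSum-primitive n (proj₂ p) (ad-linear (proj₁ p) lin) (ad-primitive lin Z-prim (proj₁ p)) a u b v))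

  letter-primitive : ∀ x → IsPrimitive (letter x)
  letter-primitive x a u b v = cong₂ _+_ (trans (cong (when (x ≡ᵇ a)) (splitCount-[]-∷ u b v)) (when-0 _)) (when-0 _)

module NatBool where
  open import Data.Bool using (true; false; if_then_else_)
  open import Relation.Binary.PropositionalEquality
  open import Relation.Nullary using (contradiction)
  open import Relation.Nullary.Reflects using (ofʸ; ofⁿ)

  ≡ᵇ-refl : ∀ n → (n ≡ᵇ n) ≡ true
  ≡ᵇ-refl zero    = refl
  ≡ᵇ-refl (suc n) = ≡ᵇ-refl n

  ≢⇒≡ᵇ-false : ∀ {m n} → m ≢ n → (m ≡ᵇ n) ≡ false
  ≢⇒≡ᵇ-false {m} {n} m≢n with m ≡ᵇ n | ℕ.≡ᵇ⇒≡ m n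
  ... | false | _      = refl
  ... | true  | m≡ᵇn⇒m≡n = contradiction (m≡ᵇn⇒m≡n _) m≢n

  ≤⇒≤ᵇ-true : ∀ {m n} → m ≤ n → (m ≤ᵇ n) ≡ true
  ≤⇒≤ᵇ-true {m} {n} m≤n with m ≤ᵇ n | ℕ.≤ᵇ-reflects-≤ m n
  ... | true  | _       = refl
  ... | false | ofⁿ m≰n = contradiction m≤n m≰n

  >⇒≤ᵇ-false : ∀ {m n} → n < m → (m ≤ᵇ n) ≡ false
  >⇒≤ᵇ-false {m} {n} n<m with m ≤ᵇ n | ℕ.≤ᵇ-reflects-≤ m n
  ... | false | _       = refl
  ... | true  | ofʸ m≤n = contradiction m≤n (ℕ.<⇒≱ n<m)

  module _ {A : Set} {a b : A} where

    if-true : ∀ {c} → c ≡ true → (if c then a else b) ≡ a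
    if-true refl = refl

    if-false : ∀ {c} → c ≡ false → (if c then a else b) ≡ b
    if-false refl = refl

module Segments where
  open import Data.Bool using (if_then_else_)
  open import Data.Nat using (_+_)
  open import Relation.Binary.PropositionalEquality
  open NatBool

  segment : {A : Set} → (ℕ → A) → ℕ → ℕ → List A
  segment h o zero    = []
  segment h o (suc n) = h o ∷ segment h (suc o) n

  module _ {A : Set} where

    segment-++ : ∀ (h : ℕ → A) o n₁ n₂ → segment h o (n₁ + n₂) ≡ segment h o n₁ ++ segment h (o + n₁) n₂
    segment-++ h o zero     n₂ = cong (λ o′ → segment h o′ n₂) (sym (ℕ.+-identityʳ o))
    segment-++ h o (suc n₁) n₂ =
      cong (h o ∷_) (trans (segment-++ h (suc o) n₁ n₂) (cong (λ o′ → segment h (suc o) n₁ ++ segment h o′ n₂) (sym (ℕ.+-suc o n₁))))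

    segment-cong : ∀ (h h′ : ℕ → A) o o′ n → (∀ i → i < n → h (o + i) ≡ h′ (o′ + i)) → segment h o n ≡ segment h′ o′ n
    segment-cong h h′ o o′ zero    h≗h′ = refl
    segment-cong h h′ o o′ (suc n) h≗h′ = cong₂ _∷_
      (trans (cong h (sym (ℕ.+-identityʳ o))) (trans (h≗h′ 0 (s≤s z≤n)) (cong h′ (ℕ.+-identityʳ o′))))
      (segment-cong h h′ (suc o) (suc o′) n λ i i<n →
        trans (cong h (sym (ℕ.+-suc o i))) (trans (h≗h′ (suc i) (s≤s i<n)) (cong h′ (ℕ.+-suc o′ i))))

    segment-const : ∀ (h : ℕ → A) o n c → (∀ i → i < n → h (o + i) ≡ c) → segment h o n ≡ replicate n c
    segment-const h o zero    c h≡c = refl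
    segment-const h o (suc n) c h≡c = cong₂ _∷_ (trans (cong h (sym (ℕ.+-identityʳ o))) (h≡c 0 (s≤s z≤n)))
      (segment-const h (suc o) n c λ i i<n → trans (cong h (sym (ℕ.+-suc o i))) (h≡c (suc i) (s≤s i<n)))

    map-segment : ∀ {B : Set} (g : A → B) h o n → map g (segment h o n) ≡ segment (g ∘ h) o n
    map-segment g h o zero    = refl
    map-segment g h o (suc n) = cong (g (h o) ∷_) (map-segment g h (suc o) n)

    applyUpTo≡segment : ∀ (f h : ℕ → A) o n → (∀ i → f i ≡ h (o + i)) → applyUpTo f n ≡ segment h o n
    applyUpTo≡segment f h o zero    f≗h = refl
    applyUpTo≡segment f h o (suc n) f≗h = cong₂ _∷_ (trans (f≗h 0) (cong h (ℕ.+-identityʳ o)))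
      (applyUpTo≡segment (f ∘ suc) h (suc o) n λ i → trans (f≗h (suc i)) (cong h (ℕ.+-suc o i)))

    map-oneTo : ∀ (h : ℕ → A) n → map h (oneTo n) ≡ segment h 1 n
    map-oneTo h n = trans (sym (List.map-∘ (upTo n))) (trans (List.map-upTo (h ∘ suc) n) (applyUpTo≡segment (h ∘ suc) h 1 n λ _ → refl))

  segment-at : ∀ σ → segment (at σ) 1 (length σ) ≡ σ
  segment-at []      = refl
  segment-at (a ∷ σ) = cong (a ∷_) (trans (segment-cong (at (a ∷ σ)) (at σ) 2 1 (length σ) λ _ _ → refl) (segment-at σ))

  swapAt : ℕ → List ℕ → List ℕ
  swapAt (suc zero)    (a ∷ b ∷ l) = b ∷ a ∷ l
  swapAt (suc (suc p)) (a ∷ l)     = a ∷ swapAt (suc p) l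
  swapAt _             l           = l

  swapAt-++ : ∀ P a b S → swapAt (suc (length P)) (P ++ a ∷ b ∷ S) ≡ P ++ b ∷ a ∷ S
  swapAt-++ []      a b S = refl
  swapAt-++ (c ∷ P) a b S = cong (c ∷_) (swapAt-++ P a b S)

  -- Written exactly as τ in the construction, so that τ k s is definitionally transposeAdjacent (α₁ ∸ k + s).
  transposeAdjacent : ℕ → ℕ → ℕ
  transposeAdjacent p j = if j ≡ᵇ p then p + 1 else if j ≡ᵇ p + 1 then p else j

  transposeAdjacent-p : ∀ p → transposeAdjacent p p ≡ p + 1
  transposeAdjacent-p p = if-true (≡ᵇ-refl p)

  transposeAdjacent-p+1 : ∀ p → transposeAdjacent p (p + 1) ≡ p
  transposeAdjacent-p+1 p = trans (if-false (≢⇒≡ᵇ-false (ℕ.m+1+n≢m p))) (if-true (≡ᵇ-refl (p + 1)))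

  transposeAdjacent-id : ∀ p {j} → j ≢ p → j ≢ p + 1 → transposeAdjacent p j ≡ j
  transposeAdjacent-id p j≢p j≢p+1 = trans (if-false (≢⇒≡ᵇ-false j≢p)) (if-false (≢⇒≡ᵇ-false j≢p+1))

  segment-transposeAdjacent-far : ∀ (h : ℕ → ℕ) p o n → p + 1 < o → segment (h ∘ transposeAdjacent p) o n ≡ segment h o n
  segment-transposeAdjacent-far h p o zero    p+1<o = refl
  segment-transposeAdjacent-far h p o (suc n) p+1<o = cong₂ _∷_
    (cong h (transposeAdjacent-id p (λ o≡p → ℕ.<-asym p+1<o (subst (_< p + 1) (sym o≡p) (ℕ.m<m+n p (s≤s z≤n))))
                                    (λ o≡p+1 → ℕ.<-irrefl (sym o≡p+1) p+1<o)))
    (segment-transposeAdjacent-far h p (suc o) n (ℕ.m<n⇒m<1+n p+1<o))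

  segment-transposeAdjacent : ∀ (h : ℕ → ℕ) t o n → suc t < n →
    segment (h ∘ transposeAdjacent (o + t)) o n ≡ swapAt (suc t) (segment h o n)
  segment-transposeAdjacent h zero    o (suc (suc n)) (s≤s (s≤s z≤n)) rewrite ℕ.+-identityʳ o = cong₂ _∷_
    (cong h (trans (transposeAdjacent-p o) (ℕ.+-comm o 1)))
    (cong₂ _∷_ (cong h (trans (cong (transposeAdjacent o) (ℕ.+-comm 1 o)) (transposeAdjacent-p+1 o)))
               (segment-transposeAdjacent-far h o (suc (suc o)) n (ℕ.≤-reflexive (cong suc (ℕ.+-comm o 1)))))
  segment-transposeAdjacent h (suc t) o (suc n) (s≤s t+1<n) rewrite ℕ.+-suc o t = cong₂ _∷_
    (cong h (transposeAdjacent-id (suc (o + t)) (λ o≡ → ℕ.<-irrefl o≡ o<1+o+t)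
                                                (λ o≡ → ℕ.<-irrefl o≡ (ℕ.≤-trans o<1+o+t (ℕ.m≤m+n _ 1)))))
    (segment-transposeAdjacent h t (suc o) n t+1<n)
    where
    o<1+o+t : o < suc (o + t)
    o<1+o+t = s≤s (ℕ.m≤m+n o t)

  swapAt-moveRight : ∀ (x : ℕ) P U R s → s < length U →
    swapAt (suc (length P + s)) (P ++ take s U ++ x ∷ drop s U ++ R)
    ≡ P ++ take (suc s) U ++ x ∷ drop (suc s) U ++ R
  swapAt-moveRight x P (u ∷ U) R zero    _ rewrite ℕ.+-identityʳ (length P) = swapAt-++ P x u (U ++ R)
  swapAt-moveRight x P (u ∷ U) R (suc s) (s≤s s<∣U∣) = begin
    swapAt (suc (length P + suc s)) (P ++ u ∷ take s U ++ x ∷ drop s U ++ R)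
      ≡⟨ cong₂ swapAt (cong suc (trans (ℕ.+-suc (length P) s) (cong (_+ s) (sym (length-∷ʳ P u)))))
                      (sym (List.∷ʳ-++ P u _)) ⟩
    swapAt (suc (length (P ∷ʳ u) + s)) ((P ∷ʳ u) ++ take s U ++ x ∷ drop s U ++ R)
      ≡⟨ swapAt-moveRight x (P ∷ʳ u) U R s s<∣U∣ ⟩
    (P ∷ʳ u) ++ take (suc s) U ++ x ∷ drop (suc s) U ++ R
      ≡⟨ List.∷ʳ-++ P u _ ⟩
    P ++ u ∷ take (suc s) U ++ x ∷ drop (suc s) U ++ R ∎
    where
    open ≡-Reasoning
    length-∷ʳ : ∀ (P : List ℕ) u → length (P ∷ʳ u) ≡ suc (length P)
    length-∷ʳ P u = trans (List.length-++ P) (ℕ.+-comm (length P) 1)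

module WordFormula (m : ℕ) (α β : Fin (suc m) → ℕ) where
  open import Data.Nat using (_+_)
  open import Data.Nat.Tactic.RingSolver using (solve-∀)
  open import Relation.Binary.PropositionalEquality
  open Construction m α β
  open NatBool
  open Segments
  open Functionals using (replicate-∷ʳ)

  x : ℕ
  x = β Fin.zero

  γ⁺ : ℕ → ℕ
  γ⁺ i = at γ (i + α₁)

  at-replicate : ∀ a (y : ℕ) r j → 1 ≤ j → j ≤ a → at (replicate a y ++ r) j ≡ y
  at-replicate (suc a) y r (suc zero)    _ _         = refl
  at-replicate (suc a) y r (suc (suc j)) _ (s≤s j≤a) = at-replicate a y r (suc j) (s≤s z≤n) j≤a

  at-γ-firstBlock : ∀ j → 1 ≤ j → j ≤ α₁ → at γ j ≡ x
  at-γ-firstBlock = at-replicate α₁ x _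

  n<1+n+i : ∀ n i → n < suc n + i
  n<1+n+i n i = s≤s (ℕ.m≤m+n n i)

  1+n+i∸n : ∀ n i → suc n + i ∸ n ≡ suc i
  1+n+i∸n n i = trans (cong (_∸ n) (sym (ℕ.+-suc n i))) (ℕ.m+n∸m≡n n (suc i))

  module _ (σ : List ℕ) (∣σ∣≡ρ : length σ ≡ ρ) (b : ℕ) (b<α₁ : b < α₁) where

    -- Here k = b + 1, and the word of σ̃_{k,0} starts with c = α₁ - k + 1 letters x.
    d c : ℕ
    d = α₁ ∸ suc b
    c = d + 1

    c+b≡α₁ : c + b ≡ α₁
    c+b≡α₁ = trans (rearrange d b) (ℕ.m+[n∸m]≡n b<α₁)
      where
      rearrange : ∀ d b → d + 1 + b ≡ suc b + d
      rearrange = solve-∀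

    c≤α₁ : c ≤ α₁
    c≤α₁ = subst (c ≤_) c+b≡α₁ (ℕ.m≤m+n c b)

    θ∸k+1≡c+ρ : θ ∸ suc b + 1 ≡ c + ρ
    θ∸k+1≡c+ρ = trans (cong (_+ 1) (ℕ.+-∸-comm ρ b<α₁)) (rearrange d ρ)
      where
      rearrange : ∀ d ρ → d + ρ + 1 ≡ d + 1 + ρ
      rearrange = solve-∀

    σ̃₀-head : ∀ {j} → j ≤ c → σ̃₀ σ (suc b) j ≡ j
    σ̃₀-head j≤c = if-true (≤⇒≤ᵇ-true j≤c)

    σ̃₀-middle : ∀ i → i < ρ → σ̃₀ σ (suc b) (suc c + i) ≡ at σ (suc i) + α₁
    σ̃₀-middle i i<ρ = trans (if-false (>⇒≤ᵇ-false (n<1+n+i c i)))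
      (trans (if-true (≤⇒≤ᵇ-true (subst (_≤ c + ρ) (ℕ.+-suc c i) (ℕ.+-monoʳ-≤ c i<ρ))))
             (cong (λ t → at σ t + α₁) (1+n+i∸n c i)))

    σ̃₀-tail : ∀ i → σ̃₀ σ (suc b) (suc (c + ρ) + i) ≡ c + suc i
    σ̃₀-tail i = trans (if-false (>⇒≤ᵇ-false (ℕ.≤-trans (s≤s (ℕ.m≤m+n c ρ)) (ℕ.m≤m+n (suc (c + ρ)) i))))
      (trans (if-false (>⇒≤ᵇ-false (n<1+n+i (c + ρ) i)))
             (cong (c +_) (trans (cong (suc (c + ρ) + i ∸_) θ∸k+1≡c+ρ) (1+n+i∸n (c + ρ) i))))

    word-σ̃₀ : w (σ̃ σ (suc b) 0) ≡ replicate c x ++ map γ⁺ σ ++ replicate b x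
    word-σ̃₀ = begin
      map h (oneTo θ)                                       ≡⟨ map-oneTo h θ ⟩
      segment h 1 θ                                         ≡⟨ cong (segment h 1) θ≡ ⟩
      segment h 1 (c + (ρ + b))                             ≡⟨ segment-++ h 1 c (ρ + b) ⟩
      segment h 1 c ++ segment h (suc c) (ρ + b)            ≡⟨ cong (segment h 1 c ++_) (segment-++ h (suc c) ρ b) ⟩
      segment h 1 c ++ segment h (suc c) ρ ++ segment h (suc (c + ρ)) b
        ≡⟨ cong₂ _++_ (segment-const h 1 c x firstBlock) (cong₂ _++_ middleBlock (segment-const h (suc (c + ρ)) b x lastBlock)) ⟩
      replicate c x ++ map γ⁺ σ ++ replicate b x             ∎
      where
      open ≡-Reasoning
      h : ℕ → ℕ
      h j = at γ (σ̃₀ σ (suc b) j)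
      θ≡ : θ ≡ c + (ρ + b)
      θ≡ = trans (cong (_+ ρ) (sym c+b≡α₁)) (rearrange c b ρ)
        where
        rearrange : ∀ c b ρ → c + b + ρ ≡ c + (ρ + b)
        rearrange = solve-∀
      firstBlock : ∀ i → i < c → h (1 + i) ≡ x
      firstBlock i i<c = trans (cong (at γ) (σ̃₀-head i<c)) (at-γ-firstBlock (suc i) (s≤s z≤n) (ℕ.≤-trans i<c c≤α₁))
      middleBlock : segment h (suc c) ρ ≡ map γ⁺ σ
      middleBlock = begin
        segment h (suc c) ρ           ≡⟨ segment-cong h (γ⁺ ∘ at σ) (suc c) 1 ρ (λ i i<ρ → cong (at γ) (σ̃₀-middle i i<ρ)) ⟩
        segment (γ⁺ ∘ at σ) 1 ρ       ≡⟨ map-segment γ⁺ (at σ) 1 ρ ⟨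
        map γ⁺ (segment (at σ) 1 ρ)   ≡⟨ cong (λ n → map γ⁺ (segment (at σ) 1 n)) (sym ∣σ∣≡ρ) ⟩
        map γ⁺ (segment (at σ) 1 (length σ)) ≡⟨ cong (map γ⁺) (segment-at σ) ⟩
        map γ⁺ σ                      ∎
      lastBlock : ∀ i → i < b → h (suc (c + ρ) + i) ≡ x
      lastBlock i i<b = trans (cong (at γ) (σ̃₀-tail i))
        (at-γ-firstBlock (c + suc i) (ℕ.≤-trans (s≤s z≤n) (ℕ.m≤n+m (suc i) c))
                         (subst (c + suc i ≤_) c+b≡α₁ (ℕ.+-monoʳ-≤ c i<b)))

    word-σ̃ : ∀ s → s ≤ ρ →
      w (σ̃ σ (suc b) s) ≡ replicate d x ++ take s (map γ⁺ σ) ++ x ∷ drop s (map γ⁺ σ) ++ replicate b x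
    word-σ̃ zero _ = begin
      w (σ̃ σ (suc b) 0)                                      ≡⟨ word-σ̃₀ ⟩
      replicate (d + 1) x ++ map γ⁺ σ ++ replicate b x        ≡⟨ cong (λ n → replicate n x ++ map γ⁺ σ ++ replicate b x) (ℕ.+-comm d 1) ⟩
      (x ∷ replicate d x) ++ map γ⁺ σ ++ replicate b x        ≡⟨ cong (_++ map γ⁺ σ ++ replicate b x) (replicate-∷ʳ d x) ⟨
      (replicate d x ∷ʳ x) ++ map γ⁺ σ ++ replicate b x       ≡⟨ List.∷ʳ-++ (replicate d x) x _ ⟩
      replicate d x ++ x ∷ map γ⁺ σ ++ replicate b x          ∎
      where open ≡-Reasoning
    word-σ̃ (suc s) s<ρ = begin
      map (λ j → at γ (σ̃ σ (suc b) s (transposeAdjacent (d + suc s) j))) (oneTo θ)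
        ≡⟨ map-oneTo _ θ ⟩
      segment (hₛ ∘ transposeAdjacent (d + suc s)) 1 θ
        ≡⟨ cong (λ p → segment (hₛ ∘ transposeAdjacent p) 1 θ) (ℕ.+-suc d s) ⟩
      segment (hₛ ∘ transposeAdjacent (1 + (d + s))) 1 θ
        ≡⟨ segment-transposeAdjacent hₛ (d + s) 1 θ swap-in-range ⟩
      swapAt (suc (d + s)) (segment hₛ 1 θ)
        ≡⟨ cong (swapAt (suc (d + s))) (trans (sym (map-oneTo hₛ θ)) (word-σ̃ s (ℕ.<⇒≤ s<ρ))) ⟩
      swapAt (suc (d + s)) (replicate d x ++ take s U ++ x ∷ drop s U ++ replicate b x)
        ≡⟨ cong (λ n → swapAt (suc (n + s)) (replicate d x ++ take s U ++ x ∷ drop s U ++ replicate b x)) (List.length-replicate d) ⟨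
      swapAt (suc (length (replicate d x) + s)) (replicate d x ++ take s U ++ x ∷ drop s U ++ replicate b x)
        ≡⟨ swapAt-moveRight x (replicate d x) U (replicate b x) s (subst (s <_) (sym ∣U∣≡ρ) s<ρ) ⟩
      replicate d x ++ take (suc s) U ++ x ∷ drop (suc s) U ++ replicate b x ∎
      where
      open ≡-Reasoning
      U = map γ⁺ σ
      ∣U∣≡ρ : length U ≡ ρ
      ∣U∣≡ρ = trans (List.length-map γ⁺ σ) ∣σ∣≡ρ
      hₛ : ℕ → ℕ
      hₛ j = at γ (σ̃ σ (suc b) s j)
      swap-in-range : suc (d + s) < θ
      swap-in-range = subst (_≤ θ) (cong suc (ℕ.+-suc d s))
        (ℕ.+-mono-≤ (subst (_≤ α₁) (ℕ.+-comm d 1) c≤α₁) s<ρ)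

module IntegerForm (m : ℕ) (α β : Fin (suc m) → ℕ) (1≤α₁ : 1 ≤ α Fin.zero) where
  open import Data.Nat using () renaming (_+_ to _+ℕ_)
  open import Data.Integer using (ℤ; 0ℤ; _+_; _*_)
  import Data.Integer.Properties as ℤ
  open import Relation.Binary.PropositionalEquality
  open Construction m α β
  open ListSum ℤ.+-*-commutativeRing
  open Arrangements {ℕ}
  open Sums ℤ.+-*-commutativeRing
  open PermutationSums ℤ.+-*-commutativeRing
  open Permutations using (length-perms)
  open Functionals
  open Primitivity
  open WordFormula m α β

  m′ : ℕ
  m′ = α₁ ∸ 1

  coefficient : ℕ → ℕ → ℤ
  coefficient k s = altBinom m′ (k ∸ 1) * altBinom ρ s

  Pℤ : Functional
  Pℤ f = ∑[ σ ∈ perms ρ ] ∑[ k ∈ oneTo α₁ ] ∑[ s ∈ upTo (suc ρ) ] (coefficient k s * f (w (σ̃ σ k s)))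

  α₁≡1+m′ : α₁ ≡ suc m′
  α₁≡1+m′ = sym (ℕ.m+[n∸m]≡n 1≤α₁)

  Φ : (List ℕ → ℤ) → ℕ → List ℕ → ℤ
  Φ f b W = ∑ (cuts W) (uncurry λ P S → altBinom ρ (length P) * f (replicate (m′ ∸ b) x ++ P ++ x ∷ S ++ replicate b x))

  Pℤ-summand : ∀ f σ → length σ ≡ ρ →
    ∑[ k ∈ oneTo α₁ ] ∑[ s ∈ upTo (suc ρ) ] (coefficient k s * f (w (σ̃ σ k s)))
    ≡ ∑[ b ∈ upTo (suc m′) ] (altBinom m′ b * Φ f b (map γ⁺ σ))
  Pℤ-summand f σ ∣σ∣≡ρ = begin
    ∑[ k ∈ oneTo α₁ ] ∑[ s ∈ upTo (suc ρ) ] (coefficient k s * f (w (σ̃ σ k s)))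
      ≡⟨ ∑-map suc (upTo α₁) _ ⟩
    ∑[ b ∈ upTo α₁ ] ∑[ s ∈ upTo (suc ρ) ] (coefficient (suc b) s * f (w (σ̃ σ (suc b) s)))
      ≡⟨ ∑-congᴬ (All.all-upTo α₁) (λ b b<α₁ → trans (∑-congᴬ (All.all-upTo (suc ρ)) λ s s<1+ρ → term b b<α₁ s s<1+ρ)
                                                    (∑-*ˡ (upTo (suc ρ)) (altBinom m′ b) _)) ⟩
    ∑[ b ∈ upTo α₁ ] (altBinom m′ b * ∑[ s ∈ upTo (suc ρ) ] (altBinom ρ s * F b (take s U) (drop s U)))
      ≡⟨ cong (λ n → ∑[ b ∈ upTo n ] (altBinom m′ b * ∑[ s ∈ upTo (suc ρ) ] (altBinom ρ s * F b (take s U) (drop s U)))) α₁≡1+m′ ⟩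
    ∑[ b ∈ upTo (suc m′) ] (altBinom m′ b * ∑[ s ∈ upTo (suc ρ) ] (altBinom ρ s * F b (take s U) (drop s U)))
      ≡⟨ ∑-cong (upTo (suc m′)) (λ b → cong (altBinom m′ b *_) (trans
           (cong (λ n → ∑[ s ∈ upTo (suc n) ] (altBinom ρ s * F b (take s U) (drop s U))) (sym ∣U∣≡ρ))
           (∑-upTo≈∑-cuts U (λ s P S → altBinom ρ s * F b P S)))) ⟩
    ∑[ b ∈ upTo (suc m′) ] (altBinom m′ b * Φ f b U) ∎
    where
    open ≡-Reasoning
    U = map γ⁺ σ
    ∣U∣≡ρ : length U ≡ ρ
    ∣U∣≡ρ = trans (List.length-map γ⁺ σ) ∣σ∣≡ρ
    F : ℕ → List ℕ → List ℕ → ℤ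
    F b P S = f (replicate (m′ ∸ b) x ++ P ++ x ∷ S ++ replicate b x)
    term : ∀ b → b < α₁ → ∀ s → s < suc ρ →
      coefficient (suc b) s * f (w (σ̃ σ (suc b) s)) ≡ altBinom m′ b * (altBinom ρ s * F b (take s U) (drop s U))
    term b b<α₁ s s<1+ρ = trans
      (cong (coefficient (suc b) s *_) (trans (cong f (word-σ̃ σ ∣σ∣≡ρ b b<α₁ s (ℕ.≤-pred s<1+ρ)))
        (cong (λ n → f (replicate (n ∸ suc b) x ++ take s U ++ x ∷ drop s U ++ replicate b x)) α₁≡1+m′)))
      (ℤ.*-assoc (altBinom m′ b) (altBinom ρ s) (F b (take s U) (drop s U)))

  Pℤ≡adPow : ∀ f → Pℤ f ≡ adPow x m′ (bracketSum ρ (map γ⁺ (oneTo ρ)) (letter x)) f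
  Pℤ≡adPow f = begin
    Pℤ f
      ≡⟨ ∑-congᴬ (length-perms ρ) (λ σ ∣σ∣≡ρ → Pℤ-summand f σ ∣σ∣≡ρ) ⟩
    ∑[ σ ∈ perms ρ ] ∑[ b ∈ upTo (suc m′) ] (altBinom m′ b * Φ f b (map γ⁺ σ))
      ≡⟨ ∑-swap (perms ρ) (upTo (suc m′)) _ ⟩
    ∑[ b ∈ upTo (suc m′) ] ∑[ σ ∈ perms ρ ] (altBinom m′ b * Φ f b (map γ⁺ σ))
      ≡⟨ ∑-cong (upTo (suc m′)) (λ b → trans (∑-*ˡ (perms ρ) (altBinom m′ b) _) (cong (altBinom m′ b *_) (∑-perms ρ γ⁺ (Φ f b)))) ⟩
    ∑[ b ∈ upTo (suc m′) ] (altBinom m′ b * ∑ (arrangements ρ (map γ⁺ (oneTo ρ))) (Φ f b))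
      ≡⟨ ∑-cong (upTo (suc m′)) (λ b → cong (altBinom m′ b *_) (∑-cong (arrangements ρ _) λ W → ∑-cong (cuts W) λ c →
           cong (altBinom ρ (length (proj₁ c)) *_)
             (cong f (cong (replicate (m′ ∸ b) x ++_) (sym (List.++-assoc (proj₁ c) (x ∷ proj₂ c) (replicate b x))))))) ⟩
    ∑[ b ∈ upTo (suc m′) ] (altBinom m′ b * bracketSum ρ (map γ⁺ (oneTo ρ)) (letter x) (λ z → f (replicate (m′ ∸ b) x ++ z ++ replicate b x)))
      ≡⟨ adPow-closed x m′ _ (bracketSum-linear ρ _ (letter-linear x)) f ⟨
    adPow x m′ (bracketSum ρ (map γ⁺ (oneTo ρ)) (letter x)) f ∎
    where open ≡-Reasoning

  Pℤ-primitive : IsPrimitive Pℤ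
  Pℤ-primitive a u b v = trans (Pℤ≡adPow _)
    (adPow-primitive x m′ (bracketSum-linear ρ _ (letter-linear x)) (bracketSum-primitive ρ _ (letter-linear x) (letter-primitive x)) a u b v)

  Pℤ-cong-nonempty : ∀ {f f′} → (∀ a r → f (a ∷ r) ≡ f′ (a ∷ r)) → Pℤ f ≡ Pℤ f′
  Pℤ-cong-nonempty {f} {f′} f≗f′ =
    ∑-cong (perms ρ) λ σ → ∑-cong (oneTo α₁) λ k → ∑-cong (upTo (suc ρ)) λ s →
      cong (coefficient k s *_) (onWords (λ i → at γ (σ̃ σ k s i)))
    where
    onWords : ∀ h → f (map h (oneTo θ)) ≡ f′ (map h (oneTo θ))
    onWords h = subst (λ n → f (map h (oneTo n)) ≡ f′ (map h (oneTo n))) (sym (cong (_+ℕ ρ) α₁≡1+m′)) (f≗f′ _ _)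

  Pℤ-coproduct : ∀ u v → Pℤ (λ w → splitCount w u v) ≡ Pℤ (λ w → trivialSplitCount w u v)
  Pℤ-coproduct []      v       = Pℤ-cong-nonempty {λ w → splitCount w [] v} {λ w → trivialSplitCount w [] v} λ a r →
    trans (splitCount-[]ˡ (a ∷ r) v) (sym (trans (ℤ.+-identityˡ _) (ℤ.*-identityˡ _)))
  Pℤ-coproduct (a ∷ u) []      = Pℤ-cong-nonempty {λ w → splitCount w (a ∷ u) []} {λ w → trivialSplitCount w (a ∷ u) []} λ c r →
    trans (splitCount-[]ʳ (c ∷ r) (a ∷ u)) (sym (trans (ℤ.+-identityʳ _) (ℤ.*-identityʳ _)))
  Pℤ-coproduct (a ∷ u) (b ∷ v) = trans (Pℤ-primitive a u b v) (sym (trans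
    (Pℤ-cong-nonempty {λ w → trivialSplitCount w (a ∷ u) (b ∷ v)} {λ _ → 0ℤ} λ c r →
      trans (cong (_+ 0ℤ) (ℤ.*-zeroʳ (δ (c ∷ r) (a ∷ u)))) (ℤ.+-identityʳ 0ℤ))
    Pℤ-zero))
    where
    Pℤ-zero : Pℤ (λ _ → 0ℤ) ≡ 0ℤ
    Pℤ-zero = trans (Pℤ≡adPow _) (IsLinear.0-homo (adPow-linear x m′ (bracketSum-linear ρ _ (letter-linear x))))

module Transfer {c ℓ : Level} (R : CommutativeRing c ℓ) where
  open import Data.Bool using (true; false)
  open import Data.Nat using (_≟_) renaming (_+_ to _+ℕ_)
  open import Data.Integer as ℤ using (ℤ; +_; -[1+_]; _⊖_)
  import Data.Integer.Properties as ℤ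
  open import Data.List.Properties using (≡-dec)
  open import Relation.Nullary using (yes; no)
  open import Relation.Nullary.Negation using (contradiction)
  open CommutativeRing R hiding (zero)
  open ListSum R
  open import Relation.Binary.Reasoning.Setoid setoid
  open import Algebra.Properties.Ring ring using (-‿+-comm; -0#≈0#; -‿distribˡ-*)
  open import Algebra.Properties.Group +-group using (⁻¹-involutive)
  module ℤ∑ = ListSum ℤ.+-*-commutativeRing
  open Functionals using (sgnℤ)
  open Primitivity using (δ; splitCount; trivialSplitCount; whenHead; whenHead-cong; when)
  open NatBool using (≡ᵇ-refl; ≢⇒≡ᵇ-false)
  open ISPW R

  ι : ℤ → Carrier
  ι (+ n)      = ℕ→R R n
  ι -[1+ n ]   = - ℕ→R R (suc n)

  ℕ→R-+ : ∀ m n → ℕ→R R (m +ℕ n) ≈ ℕ→R R m + ℕ→R R n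
  ℕ→R-+ zero    n = sym (+-identityˡ _)
  ℕ→R-+ (suc m) n = trans (+-congˡ (ℕ→R-+ m n)) (sym (+-assoc _ _ _))

  ι-⊖ : ∀ m n → ι (m ⊖ n) ≈ ℕ→R R m - ℕ→R R n
  ι-⊖ m       zero    = sym (trans (+-congˡ -0#≈0#) (+-identityʳ _))
  ι-⊖ zero    (suc n) = sym (+-identityˡ _)
  ι-⊖ (suc m) (suc n) = begin
    ι (suc m ⊖ suc n)                         ≡⟨ ≡.cong ι (ℤ.[1+m]⊖[1+n]≡m⊖n m n) ⟩
    ι (m ⊖ n)                                 ≈⟨ ι-⊖ m n ⟩
    ℕ→R R m - ℕ→R R n                        ≈⟨ cancel 1# (ℕ→R R m) (ℕ→R R n) ⟨
    (1# + ℕ→R R m) - (1# + ℕ→R R n)          ∎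
    where
    cancel : ∀ o a b → (o + a) - (o + b) ≈ a - b
    cancel o a b = begin
      (o + a) - (o + b)     ≈⟨ +-congˡ (sym (-‿+-comm o b)) ⟩
      (o + a) + (- o + - b) ≈⟨ interchange o a (- o) (- b) ⟩
      (o - o) + (a - b)     ≈⟨ +-congʳ (-‿inverseʳ o) ⟩
      0# + (a - b)          ≈⟨ +-identityˡ _ ⟩
      a - b                 ∎
      where open import Algebra.Properties.CommutativeSemigroup +-commutativeSemigroup using (interchange)

  ι-+ : ∀ i j → ι (i ℤ.+ j) ≈ ι i + ι j
  ι-+ (+ m)      (+ n)      = ℕ→R-+ m n
  ι-+ (+ m)      -[1+ n ]   = ι-⊖ m (suc n)
  ι-+ -[1+ m ]   (+ n)      = trans (ι-⊖ n (suc m)) (+-comm _ _)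
  ι-+ -[1+ m ]   -[1+ n ]   = begin
    - ℕ→R R (suc (suc (m +ℕ n)))            ≡⟨ ≡.cong (λ k → - ℕ→R R (suc k)) (ℕ.+-suc m n) ⟨
    - ℕ→R R (suc m +ℕ suc n)                ≈⟨ -‿cong (ℕ→R-+ (suc m) (suc n)) ⟩
    - (ℕ→R R (suc m) + ℕ→R R (suc n))         ≈⟨ -‿+-comm _ _ ⟨
    - ℕ→R R (suc m) + - ℕ→R R (suc n)         ∎

  ι-neg : ∀ i → ι (ℤ.- i) ≈ - ι i
  ι-neg (+ zero)  = sym -0#≈0#
  ι-neg (+ suc n) = refl
  ι-neg -[1+ n ]  = sym (⁻¹-involutive _)

  ι-*-pos : ∀ n j → ι (+ n ℤ.* j) ≈ ℕ→R R n * ι j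
  ι-*-pos zero    j = sym (zeroˡ (ι j))
  ι-*-pos (suc n) j = begin
    ι (+ suc n ℤ.* j)          ≡⟨ ≡.cong ι (ℤ.suc-* (+ n) j) ⟩
    ι (j ℤ.+ + n ℤ.* j)        ≈⟨ ι-+ j (+ n ℤ.* j) ⟩
    ι j + ι (+ n ℤ.* j)        ≈⟨ +-cong (sym (*-identityˡ (ι j))) (ι-*-pos n j) ⟩
    1# * ι j + ℕ→R R n * ι j  ≈⟨ distribʳ (ι j) 1# (ℕ→R R n) ⟨
    ℕ→R R (suc n) * ι j       ∎

  ι-* : ∀ i j → ι (i ℤ.* j) ≈ ι i * ι j
  ι-* (+ n)    j = ι-*-pos n j
  ι-* -[1+ n ] j = begin
    ι (-[1+ n ] ℤ.* j)            ≡⟨ ≡.cong ι (ℤ.neg-distribˡ-* (+ suc n) j) ⟨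
    ι (ℤ.- (+ suc n ℤ.* j))       ≈⟨ ι-neg (+ suc n ℤ.* j) ⟩
    - ι (+ suc n ℤ.* j)           ≈⟨ -‿cong (ι-*-pos (suc n) j) ⟩
    - (ℕ→R R (suc n) * ι j)       ≈⟨ -‿distribˡ-* _ _ ⟩
    - ℕ→R R (suc n) * ι j         ∎

  ι-sgn : ∀ e → ι (sgnℤ e) ≈ sgn R e
  ι-sgn zero    = +-identityʳ 1#
  ι-sgn (suc e) = trans (ι-neg (sgnℤ e)) (-‿cong (ι-sgn e))

  ∑-ι : ∀ {a} {A : Set a} (xs : List A) k (f : A → ℤ) → ∑[ x ∈ xs ] (k * ι (f x)) ≈ k * ι (ℤ∑.∑ xs f)
  ∑-ι []       k f = sym (zeroʳ k)
  ∑-ι (x ∷ xs) k f = trans (+-congˡ (∑-ι xs k f)) (trans (sym (distribˡ k _ _)) (*-congˡ (sym (ι-+ (f x) _))))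

  δ-refl : ∀ w → δ w w ≡ ℤ.1ℤ
  δ-refl []      = ≡.refl
  δ-refl (a ∷ w) rewrite ≡ᵇ-refl a = δ-refl w

  δ-≢ : ∀ w u → w ≢ u → δ w u ≡ ℤ.0ℤ
  δ-≢ []      []      w≢u = contradiction ≡.refl w≢u
  δ-≢ []      (_ ∷ _) w≢u = ≡.refl
  δ-≢ (a ∷ w) []      w≢u = ≡.refl
  δ-≢ (a ∷ w) (b ∷ u) w≢u with a ≟ b
  ... | yes ≡.refl rewrite ≡ᵇ-refl a = δ-≢ w u (λ w≡u → w≢u (≡.cong (a ∷_) w≡u))
  ... | no  a≢b    rewrite ≢⇒≡ᵇ-false a≢b = ≡.refl

  coeff₂-++ : ∀ p q u v → coeff₂ (p ++ q) u v ≈ coeff₂ p u v + coeff₂ q u v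
  coeff₂-++ []                  q u v = sym (+-identityˡ _)
  coeff₂-++ ((a , u′ , v′) ∷ p) q u v with ≡-dec _≟_ u′ u | ≡-dec _≟_ v′ v
  ... | yes _ | yes _ = trans (+-congˡ (coeff₂-++ p q u v)) (sym (+-assoc _ _ _))
  ... | yes _ | no  _ = coeff₂-++ p q u v
  ... | no  _ | _     = coeff₂-++ p q u v

  coeff₂-map : ∀ {a} {A : Set a} (ts : List A) (coeffOf : A → Carrier) (left right : A → List ℕ) u v →
    coeff₂ (map (λ t → coeffOf t , left t , right t) ts) u v ≈ ∑[ t ∈ ts ] (coeffOf t * ι (δ (left t) u ℤ.* δ (right t) v))
  coeff₂-map []       coeffOf left right u v = refl
  coeff₂-map (t ∷ ts) coeffOf left right u v with ≡-dec _≟_ (left t) u | ≡-dec _≟_ (right t) v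
  ... | yes ≡.refl | yes ≡.refl rewrite δ-refl (left t) | δ-refl (right t) =
    +-cong (sym (trans (*-congˡ (+-identityʳ 1#)) (*-identityʳ _))) (coeff₂-map ts coeffOf left right u v)
  ... | yes _      | no  r≢v rewrite δ-≢ (right t) v r≢v | ℤ.*-zeroʳ (δ (left t) u) =
    trans (coeff₂-map ts coeffOf left right u v) (sym (trans (+-congʳ (zeroʳ _)) (+-identityˡ _)))
  ... | no  l≢u    | _        rewrite δ-≢ (left t) u l≢u =
    trans (coeff₂-map ts coeffOf left right u v) (sym (trans (+-congʳ (zeroʳ _)) (+-identityˡ _)))

  private
    when-*ˡ : ∀ b x y → when b x ℤ.* y ≡ when b (x ℤ.* y)
    when-*ˡ true  x y = ≡.refl
    when-*ˡ false x y = ≡.refl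

    when-*ʳ : ∀ b x y → x ℤ.* when b y ≡ when b (x ℤ.* y)
    when-*ʳ true  x y = ≡.refl
    when-*ʳ false x y = ℤ.*-zeroʳ x

    ∑-when : ∀ {A : Set} (xs : List A) b (f : A → ℤ) → ℤ∑.∑ xs (λ x → when b (f x)) ≡ when b (ℤ∑.∑ xs f)
    ∑-when xs true  f = ≡.refl
    ∑-when xs false f = ℤ∑.∑-zero xs (λ _ → ≡.refl)

  ∑-splits-headˡ : ∀ a (lrs : List (List ℕ × List ℕ)) u v →
    ℤ∑.∑ lrs (λ lr → δ (a ∷ proj₁ lr) u ℤ.* δ (proj₂ lr) v)
    ≡ whenHead a (λ u′ → ℤ∑.∑ lrs (λ lr → δ (proj₁ lr) u′ ℤ.* δ (proj₂ lr) v)) u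
  ∑-splits-headˡ a lrs []      v = ℤ∑.∑-zero lrs (λ _ → ≡.refl)
  ∑-splits-headˡ a lrs (b ∷ u) v =
    ≡.trans (ℤ∑.∑-cong lrs λ lr → when-*ˡ (a ≡ᵇ b) (δ (proj₁ lr) u) (δ (proj₂ lr) v)) (∑-when lrs (a ≡ᵇ b) _)

  ∑-splits-headʳ : ∀ a (lrs : List (List ℕ × List ℕ)) u v →
    ℤ∑.∑ lrs (λ lr → δ (proj₁ lr) u ℤ.* δ (a ∷ proj₂ lr) v)
    ≡ whenHead a (λ v′ → ℤ∑.∑ lrs (λ lr → δ (proj₁ lr) u ℤ.* δ (proj₂ lr) v′)) v
  ∑-splits-headʳ a lrs u []      = ℤ∑.∑-zero lrs (λ lr → ℤ.*-zeroʳ (δ (proj₁ lr) u))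
  ∑-splits-headʳ a lrs u (b ∷ v) =
    ≡.trans (ℤ∑.∑-cong lrs λ lr → when-*ʳ (a ≡ᵇ b) (δ (proj₁ lr) u) (δ (proj₂ lr) v)) (∑-when lrs (a ≡ᵇ b) _)

  ∑-splits : ∀ w u v → ℤ∑.∑ (splits w) (λ lr → δ (proj₁ lr) u ℤ.* δ (proj₂ lr) v) ≡ splitCount w u v
  ∑-splits []      []      []      = ≡.refl
  ∑-splits []      []      (_ ∷ _) = ≡.refl
  ∑-splits []      (_ ∷ _) []      = ≡.refl
  ∑-splits []      (_ ∷ _) (_ ∷ _) = ≡.refl
  ∑-splits (a ∷ w) u v = ≡.trans (ℤ∑.∑-concatMap _ (splits w) _) (≡.trans
    (ℤ∑.∑-cong (splits w) λ lr → ≡.cong (λ t → δ (a ∷ proj₁ lr) u ℤ.* δ (proj₂ lr) v ℤ.+ t) (ℤ.+-identityʳ _)) (≡.trans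
    (ℤ∑.∑-+ (splits w) _ _)
    (≡.cong₂ ℤ._+_ (≡.trans (∑-splits-headˡ a (splits w) u v) (whenHead-cong a (λ u′ → ∑-splits w u′ v) u))
                   (≡.trans (∑-splits-headʳ a (splits w) u v) (whenHead-cong a (∑-splits w u) v)))))

  coeff₂-Δ : ∀ p u v → coeff₂ (Δ p) u v ≈ ∑[ aw ∈ p ] (proj₁ aw * ι (splitCount (proj₂ aw) u v))
  coeff₂-Δ []            u v = refl
  coeff₂-Δ ((a , w) ∷ p) u v = begin
    coeff₂ (map (λ lr → a , proj₁ lr , proj₂ lr) (splits w) ++ Δ p) u v
      ≈⟨ coeff₂-++ (map (λ lr → a , proj₁ lr , proj₂ lr) (splits w)) (Δ p) u v ⟩
    coeff₂ (map (λ lr → a , proj₁ lr , proj₂ lr) (splits w)) u v + coeff₂ (Δ p) u v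
      ≈⟨ +-cong (coeff₂-map (splits w) (λ _ → a) proj₁ proj₂ u v) (coeff₂-Δ p u v) ⟩
    ∑[ lr ∈ splits w ] (a * ι (δ (proj₁ lr) u ℤ.* δ (proj₂ lr) v)) + ∑[ aw ∈ p ] (proj₁ aw * ι (splitCount (proj₂ aw) u v))
      ≈⟨ +-congʳ (trans (∑-ι (splits w) a _) (*-congˡ (reflexive (≡.cong ι (∑-splits w u v))))) ⟩
    a * ι (splitCount w u v) + ∑[ aw ∈ p ] (proj₁ aw * ι (splitCount (proj₂ aw) u v)) ∎

  coeff₂-prim-rhs : ∀ p u v → coeff₂ (prim-rhs p) u v ≈ ∑[ aw ∈ p ] (proj₁ aw * ι (trivialSplitCount (proj₂ aw) u v))
  coeff₂-prim-rhs p u v = begin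
    coeff₂ (map (λ aw → proj₁ aw , proj₂ aw , []) p ++ map (λ aw → proj₁ aw , [] , proj₂ aw) p) u v
      ≈⟨ coeff₂-++ (map (λ aw → proj₁ aw , proj₂ aw , []) p) (map (λ aw → proj₁ aw , [] , proj₂ aw) p) u v ⟩
    coeff₂ (map (λ aw → proj₁ aw , proj₂ aw , []) p) u v + coeff₂ (map (λ aw → proj₁ aw , [] , proj₂ aw) p) u v
      ≈⟨ +-cong (coeff₂-map p proj₁ proj₂ (λ _ → []) u v) (coeff₂-map p proj₁ (λ _ → []) proj₂ u v) ⟩
    ∑[ aw ∈ p ] (proj₁ aw * ι (δ (proj₂ aw) u ℤ.* δ [] v)) + ∑[ aw ∈ p ] (proj₁ aw * ι (δ [] u ℤ.* δ (proj₂ aw) v))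
      ≈⟨ ∑-+ p _ _ ⟨
    ∑[ aw ∈ p ] (proj₁ aw * ι (δ (proj₂ aw) u ℤ.* δ [] v) + proj₁ aw * ι (δ [] u ℤ.* δ (proj₂ aw) v))
      ≈⟨ ∑-cong p (λ aw → trans (sym (distribˡ _ _ _)) (*-congˡ (sym (ι-+ (δ (proj₂ aw) u ℤ.* δ [] v) (δ [] u ℤ.* δ (proj₂ aw) v))))) ⟩
    ∑[ aw ∈ p ] (proj₁ aw * ι (trivialSplitCount (proj₂ aw) u v)) ∎

  ι-altBinom : ∀ n k → ι (Functionals.altBinom n k) ≈ sgn R k * ℕ→R R (n C k)
  ι-altBinom n k = trans (ι-* (sgnℤ k) (+ (n C k))) (*-congʳ (ι-sgn k))

module PrimitivityOfP {c ℓ : Level} (R : CommutativeRing c ℓ) (m : ℕ) (α β : Fin (suc m) → ℕ) (1≤α₁ : 1 ≤ α Fin.zero)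
                      (inv : CommutativeRing.Carrier R) where
  open import Data.Integer as ℤ using (ℤ)
  open CommutativeRing R
  open ListSum R
  open import Relation.Binary.Reasoning.Setoid setoid
  open ISPW R
  open Construction m α β
  open Transfer R
  open IntegerForm m α β 1≤α₁
  open Functionals using (altBinom)

  ∑-P : ∀ (h : List ℕ → ℤ) → ∑[ aw ∈ P R inv ] (proj₁ aw * ι (h (proj₂ aw))) ≈ inv * ι (Pℤ h)
  ∑-P h = begin
    ∑[ aw ∈ P R inv ] (proj₁ aw * ι (h (proj₂ aw)))
      ≈⟨ ∑-concatMap _ (perms ρ) _ ⟩
    ∑[ σ ∈ perms ρ ] ∑[ aw ∈ concatMap (λ k → map (λ s → entry σ k s) (upTo (suc ρ))) (oneTo α₁) ] (proj₁ aw * ι (h (proj₂ aw)))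
      ≈⟨ ∑-cong (perms ρ) (λ σ → trans (∑-concatMap _ (oneTo α₁) _) (∑-cong (oneTo α₁) λ k →
           trans (∑-map (entry σ k) (upTo (suc ρ)) _) (∑-cong (upTo (suc ρ)) λ s → term σ k s))) ⟩
    ∑[ σ ∈ perms ρ ] ∑[ k ∈ oneTo α₁ ] ∑[ s ∈ upTo (suc ρ) ] (inv * ι (coefficient k s ℤ.* h (w (σ̃ σ k s))))
      ≈⟨ ∑-cong (perms ρ) (λ σ → trans (∑-cong (oneTo α₁) λ k → ∑-ι (upTo (suc ρ)) inv (λ s → coefficient k s ℤ.* h (w (σ̃ σ k s))))
                                       (∑-ι (oneTo α₁) inv (λ k → ℤ∑.∑ (upTo (suc ρ)) λ s → coefficient k s ℤ.* h (w (σ̃ σ k s))))) ⟩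
    ∑[ σ ∈ perms ρ ] (inv * ι (ℤ∑.∑ (oneTo α₁) λ k → ℤ∑.∑ (upTo (suc ρ)) λ s → coefficient k s ℤ.* h (w (σ̃ σ k s))))
      ≈⟨ ∑-ι (perms ρ) inv (λ σ → ℤ∑.∑ (oneTo α₁) λ k → ℤ∑.∑ (upTo (suc ρ)) λ s → coefficient k s ℤ.* h (w (σ̃ σ k s))) ⟩
    inv * ι (Pℤ h) ∎
    where
    entry : List ℕ → ℕ → ℕ → Carrier × List ℕ
    entry σ k s = inv * ((sgn R (k ∸ 1) * ℕ→R R ((α₁ ∸ 1) C (k ∸ 1))) * (sgn R s * ℕ→R R (ρ C s))) , w (σ̃ σ k s)
    term : ∀ σ k s → proj₁ (entry σ k s) * ι (h (proj₂ (entry σ k s))) ≈ inv * ι (coefficient k s ℤ.* h (w (σ̃ σ k s)))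
    term σ k s = begin
      inv * (A * B) * ι (h (w (σ̃ σ k s)))                      ≈⟨ *-assoc _ _ _ ⟩
      inv * (A * B * ι (h (w (σ̃ σ k s))))                      ≈⟨ *-congˡ (*-congʳ (*-cong (ι-altBinom (α₁ ∸ 1) (k ∸ 1)) (ι-altBinom ρ s))) ⟨
      inv * (ι (altBinom (α₁ ∸ 1) (k ∸ 1)) * ι (altBinom ρ s) * ι (h (w (σ̃ σ k s))))
        ≈⟨ *-congˡ (*-congʳ (ι-* (altBinom (α₁ ∸ 1) (k ∸ 1)) (altBinom ρ s))) ⟨
      inv * (ι (coefficient k s) * ι (h (w (σ̃ σ k s))))        ≈⟨ *-congˡ (ι-* (coefficient k s) (h (w (σ̃ σ k s)))) ⟨
      inv * ι (coefficient k s ℤ.* h (w (σ̃ σ k s)))           ∎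
      where
      A = sgn R (k ∸ 1) * ℕ→R R ((α₁ ∸ 1) C (k ∸ 1))
      B = sgn R s * ℕ→R R (ρ C s)

  P-primitive : Primitive (P R inv)
  P-primitive u v = begin
    coeff₂ (Δ (P R inv)) u v                                                ≈⟨ coeff₂-Δ (P R inv) u v ⟩
    ∑[ aw ∈ P R inv ] (proj₁ aw * ι (splitCount (proj₂ aw) u v))            ≈⟨ ∑-P (λ w → splitCount w u v) ⟩
    inv * ι (Pℤ (λ w → splitCount w u v))                                   ≡⟨ ≡.cong (λ t → inv * ι t) (Pℤ-coproduct u v) ⟩
    inv * ι (Pℤ (λ w → trivialSplitCount w u v))                            ≈⟨ ∑-P (λ w → trivialSplitCount w u v) ⟨
    ∑[ aw ∈ P R inv ] (proj₁ aw * ι (trivialSplitCount (proj₂ aw) u v))    ≈⟨ coeff₂-prim-rhs (P R inv) u v ⟨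
    coeff₂ (prim-rhs (P R inv)) u v                                          ∎
    where open Primitivity using (splitCount; trivialSplitCount)

mainTheorem6 : {c ℓ : Level} (K : CharZeroField c ℓ) (m : ℕ)
    (α β : Fin (suc m) → ℕ)
    → (∀ i → 1 ≤ α i) → (∀ i → 1 ≤ β i)
    → (∀ i j → i ≢ j → β i ≢ β j)
    → (inv : CharZeroField.Carrier K)
    → CharZeroField._≈_ K
        (CharZeroField._*_ K inv (ℕ→R (CharZeroField.cring K) (Construction.factProd m α β)))
        (CharZeroField.1# K)
    → ISPW.Primitive (CharZeroField.cring K)
        (Construction.P m α β (CharZeroField.cring K) inv)
mainTheorem6 K m α β 1≤α _ _ inv _ = PrimitivityOfP.P-primitive (CharZeroField.cring K) m α β (1≤α Fin.zero) inv
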